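{- Let $\mathrm{BiPar}_n$ be the set of bidiagonal matrices in $\mathrm{Par}_n$. Then, as formal power series, $$\sum_{n\ge0}\sum_{A\in\mathrm{BiPar}_n}q^{\dim(A)}x^n=\frac{2x^3-(q+5)x^2+(q+4)x-1}{2(q^2+q+1)x^3-(q^2+4q+5)x^2+2(q+2)x-1}.$$
   Context: $[a,b]=\{i\in\mathbb Z:a\le i\le b\}$. A partition matrix on $[1,n]$ is a square upper triangular matrix whose entries are subsets of $[1,n]$ such that: (i) every row and every column contains at least one non-empty entry; (ii) the non-empty entries partition $[1,n]$; (iii) for all $i,j$, $\mathrm{col}(i)<\mathrm{col}(j)$ implies $i<j$, where $\mathrm{col}(i)$ is the column index of the entry containing $i$. $\mathrm{Par}_n$ is the set of partition matrices on $[1,n]$, with $\mathrm{Par}_0$ consisting of the empty matrix of dimension $0$. $\dim(A)$ is the number of rows of $A$. A matrix is bidiagonal if it is upper triangular and $A_{ij}=\emptyset$ whenever $j-i\ge2$. -}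

module Defs where

open import Data.Bool using (Bool; true; false; not; _∧_; if_then_else_)
open import Data.Nat using (ℕ; zero; suc; _<ᵇ_; _+_)
open import Data.Fin using (Fin; toℕ)
open import Data.Vec using (Vec; []; _∷_; lookup)
open import Data.List using (List; []; _∷_; [_]; map; concatMap; allFin; length; filter)
open import Data.Bool.ListAction using (all; any)
open import Data.Fin.Subset using (Subset)
open import Data.Integer using (ℤ; +_; -[1+_]) renaming (_+_ to _+ℤ_; _*_ to _*ℤ_)
open import Data.Nat using (_∸_)

-- Matrices of subsets of [1,n] (elements encoded as Fin n, i.e. 0..n-1,
-- with the order preserved), of dimension d × d.

Matrix : ℕ → ℕ → Set
Matrix n d = Vec (Vec (Subset n) d) d

entry : ∀ {n d} → Matrix n d → Fin d → Fin d → Subset n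
entry M i j = lookup (lookup M i) j

_∈ᵇ_ : ∀ {n} → Fin n → Subset n → Bool
x ∈ᵇ S = lookup S x

isEmpty : ∀ {n} → Subset n → Bool
isEmpty {n} S = all (λ x → not (x ∈ᵇ S)) (allFin n)

∀ᵇ : ∀ {k} → (Fin k → Bool) → Bool
∀ᵇ {k} p = all p (allFin k)

∃ᵇ : ∀ {k} → (Fin k → Bool) → Bool
∃ᵇ {k} p = any p (allFin k)

_⇒ᵇ_ : Bool → Bool → Bool
a ⇒ᵇ b = not a Data.Bool.∨ b

cellsContaining : ∀ {n d} → Matrix n d → Fin n → ℕ
cellsContaining {n} {d} M x =
  length (filter (λ ij → Data.Bool._≟_ (x ∈ᵇ entry M (Data.Product.proj₁ ij) (Data.Product.proj₂ ij)) true)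
                 (concatMap (λ i → map (λ j → i Data.Product., j) (allFin d)) (allFin d)))
  where import Data.Product

upperTriangularᵇ : ∀ {n d} → Matrix n d → Bool
upperTriangularᵇ M = ∀ᵇ λ i → ∀ᵇ λ j → (toℕ j <ᵇ toℕ i) ⇒ᵇ isEmpty (entry M i j)

rowsColsNonEmptyᵇ : ∀ {n d} → Matrix n d → Bool
rowsColsNonEmptyᵇ M =
  (∀ᵇ λ i → ∃ᵇ λ j → not (isEmpty (entry M i j))) ∧
  (∀ᵇ λ j → ∃ᵇ λ i → not (isEmpty (entry M i j)))

partitionᵇ : ∀ {n d} → Matrix n d → Bool
partitionᵇ M = ∀ᵇ λ x → isOne (cellsContaining M x)
  where
  isOne : ℕ → Bool
  isOne (suc zero) = true
  isOne _ = false

colOrderᵇ : ∀ {n d} → Matrix n d → Bool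
colOrderᵇ M =
  ∀ᵇ λ x → ∀ᵇ λ y → ∀ᵇ λ i → ∀ᵇ λ j → ∀ᵇ λ i' → ∀ᵇ λ j' →
    ((x ∈ᵇ entry M i j) ∧ (y ∈ᵇ entry M i' j') ∧ (toℕ j <ᵇ toℕ j'))
      ⇒ᵇ (toℕ x <ᵇ toℕ y)

isPartitionMatrixᵇ : ∀ {n d} → Matrix n d → Bool
isPartitionMatrixᵇ M =
  upperTriangularᵇ M ∧ rowsColsNonEmptyᵇ M ∧ partitionᵇ M ∧ colOrderᵇ M

bidiagonalᵇ : ∀ {n d} → Matrix n d → Bool
bidiagonalᵇ M = upperTriangularᵇ M ∧
  (∀ᵇ λ i → ∀ᵇ λ j → (suc (toℕ i) <ᵇ toℕ j) ⇒ᵇ isEmpty (entry M i j))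

isBiParᵇ : ∀ {n d} → Matrix n d → Bool
isBiParᵇ M = isPartitionMatrixᵇ M ∧ bidiagonalᵇ M

allVecs : ∀ {A : Set} → List A → (k : ℕ) → List (Vec A k)
allVecs xs zero = [ [] ]
allVecs xs (suc k) = concatMap (λ x → map (x ∷_) (allVecs xs k)) xs

allSubsets : (n : ℕ) → List (Subset n)
allSubsets n = allVecs (true ∷ false ∷ []) n

allMatrices : (n d : ℕ) → List (Matrix n d)
allMatrices n d = allVecs (allVecs (allSubsets n) d) d

countᵇ : ∀ {A : Set} → (A → Bool) → List A → ℕ
countᵇ p [] = 0
countᵇ p (x ∷ xs) = if p x then suc (countᵇ p xs) else countᵇ p xs

biParCount : ℕ → ℕ → ℕ
biParCount n d = countᵇ isBiParᵇ (allMatrices n d)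

-- Formal power series in x and q with integer coefficients:
-- S n d = coefficient of x^n q^d.

Series : Set
Series = ℕ → ℕ → ℤ

sumTo : ℕ → (ℕ → ℤ) → ℤ
sumTo zero f = f 0
sumTo (suc n) f = sumTo n f +ℤ f (suc n)

_⋆_ : Series → Series → Series
(f ⋆ g) n d = sumTo n λ i → sumTo d λ j → f i j *ℤ g (n ∸ i) (d ∸ j)

biParSeries : Series
biParSeries n d = + biParCount n d

-- numerator 2x^3 - (q+5)x^2 + (q+4)x - 1
numer : Series
numer 0 0 = -[1+ 0 ]
numer 1 0 = + 4
numer 1 1 = + 1
numer 2 0 = -[1+ 4 ]
numer 2 1 = -[1+ 0 ]
numer 3 0 = + 2
numer _ _ = + 0

-- denominator 2(q^2+q+1)x^3 - (q^2+4q+5)x^2 + 2(q+2)x - 1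
denom : Series
denom 0 0 = -[1+ 0 ]
denom 1 0 = + 4
denom 1 1 = + 2
denom 2 0 = -[1+ 4 ]
denom 2 1 = -[1+ 3 ]
denom 2 2 = -[1+ 0 ]
denom 3 0 = + 2
denom 3 1 = + 2
denom 3 2 = + 2
denom _ _ = + 0

module Submission where

-- In a bidiagonal partition matrix every element lies in some column c,
-- on the diagonal (row c) or on the superdiagonal (row c - 1), and by (iii)
-- the columns increase with the elements.  So a matrix is a word of cells,
-- one per element, and the conditions (i)-(iii) become conditions on the
-- word (CellWords: isBiParᵇ (matrixOf v) holds iff v is Admissible).  Read
-- from left to right, a word only needs to remember its current column k
-- and whether rows k and k - 1 are occupied yet; this is a deterministic
-- automaton accepting exactly the admissible words (Automaton), and its
-- accepted words are counted by the recursion Ways (AcceptedCount).  As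
-- series, the counts Z, A, B, C satisfy four linear equations and
-- F = 1 + xqZ (Transfer).  Eliminating Z, A, B, C gives (1 - x)(F D - N) = 0
-- through an explicit certificate, checked by collecting like terms in
-- formal linear combinations of shifted series (LinearCombinations); as 1 - x is
-- cancellable, F D = N.

open import Defs
open import Relation.Binary.Definitions using (DecidableEquality)

module Series where

  open import Defs
  open import Data.Nat as ℕ using (ℕ; zero; suc; _∸_; z≤n; s≤s) renaming (_≤_ to _≤ℕ_; _<_ to _<ℕ_; _+_ to _+ℕ_)
  import Data.Nat.Properties as ℕP
  open import Data.Integer using (ℤ; +_; _+_; _*_; _-_)
  import Data.Integer.Properties as ℤP
  open import Data.Integer.Tactic.RingSolver using (solve-∀)
  open import Data.Sum using (inj₁; inj₂)
  open import Data.Product using (_×_; _,_)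
  open import Relation.Binary.PropositionalEquality

  𝟘 : Series
  𝟘 _ _ = + 0

  δ : Series
  δ zero zero = + 1
  δ _ _ = + 0

  -- sh i j f is the series xⁱ qʲ f.
  sh : ℕ → ℕ → Series → Series
  sh (suc i) j f zero d = + 0
  sh (suc i) j f (suc n) d = sh i j f n d
  sh zero (suc j) f n zero = + 0
  sh zero (suc j) f n (suc d) = sh zero j f n d
  sh zero zero f n d = f n d

  sh-pointwise : ∀ i j (φ : ℤ → ℤ → ℤ) → φ (+ 0) (+ 0) ≡ + 0 → ∀ (f g : Series) n d →
    sh i j (λ m e → φ (f m e) (g m e)) n d ≡ φ (sh i j f n d) (sh i j g n d)
  sh-pointwise (suc i) j φ φ0 f g zero d = sym φ0
  sh-pointwise (suc i) j φ φ0 f g (suc n) d = sh-pointwise i j φ φ0 f g n d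
  sh-pointwise zero (suc j) φ φ0 f g n zero = sym φ0
  sh-pointwise zero (suc j) φ φ0 f g n (suc d) = sh-pointwise zero j φ φ0 f g n d
  sh-pointwise zero zero φ φ0 f g n d = refl

  sh-𝟘 : ∀ i j n d → sh i j 𝟘 n d ≡ + 0
  sh-𝟘 i j = sh-pointwise i j (λ _ _ → + 0) refl 𝟘 𝟘

  sh-cong : ∀ i j {f g : Series} → (∀ n d → f n d ≡ g n d) → ∀ n d → sh i j f n d ≡ sh i j g n d
  sh-cong (suc i) j e zero d = refl
  sh-cong (suc i) j e (suc n) d = sh-cong i j e n d
  sh-cong zero (suc j) e n zero = refl
  sh-cong zero (suc j) e n (suc d) = sh-cong zero j e n d
  sh-cong zero zero e n d = e n d

  sh-q-zero : ∀ i j (f : Series) n → sh i (suc j) f n zero ≡ + 0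
  sh-q-zero (suc i) j f zero = refl
  sh-q-zero (suc i) j f (suc n) = sh-q-zero i j f n
  sh-q-zero zero j f n = refl

  sh-q-suc : ∀ i j (f : Series) n d → sh i (suc j) f n (suc d) ≡ sh i j f n d
  sh-q-suc (suc i) j f zero d = refl
  sh-q-suc (suc i) j f (suc n) d = sh-q-suc i j f n d
  sh-q-suc zero j f n d = refl

  sh-sh : ∀ i j α β (f : Series) n d → sh i j (sh α β f) n d ≡ sh (i +ℕ α) (j +ℕ β) f n d
  sh-sh (suc i) j α β f zero d = refl
  sh-sh (suc i) j α β f (suc n) d = sh-sh i j α β f n d
  sh-sh zero (suc j) α β f n zero = sym (sh-q-zero α (j +ℕ β) f n)
  sh-sh zero (suc j) α β f n (suc d) = trans (sh-sh zero j α β f n d) (sym (sh-q-suc α (j +ℕ β) f n d))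
  sh-sh zero zero α β f n d = refl

  cut : ℕ → ℕ → ℤ → ℤ
  cut zero n x = x
  cut (suc k) zero x = + 0
  cut (suc k) (suc n) x = cut k n x

  cut-≤ : ∀ k n x → k ≤ℕ n → cut k n x ≡ x
  cut-≤ zero n x _ = refl
  cut-≤ (suc k) (suc n) x (s≤s k≤n) = cut-≤ k n x k≤n

  cut-> : ∀ k n x → n <ℕ k → cut k n x ≡ + 0
  cut-> (suc k) zero x _ = refl
  cut-> (suc k) (suc n) x (s≤s n<k) = cut-> k n x n<k

  cut-+ : ∀ k n x y → cut k n (x + y) ≡ cut k n x + cut k n y
  cut-+ zero n x y = refl
  cut-+ (suc k) zero x y = refl
  cut-+ (suc k) (suc n) x y = cut-+ k n x y

  cut-* : ∀ k n c x → cut k n (c * x) ≡ c * cut k n x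
  cut-* zero n c x = refl
  cut-* (suc k) zero c x = sym (ℤP.*-zeroʳ c)
  cut-* (suc k) (suc n) c x = cut-* k n c x

  -- The coefficient of xⁿqᵈ in xᵏqˡf, with truncated subtraction made explicit.
  sh-cut : ∀ k l (f : Series) n d → sh k l f n d ≡ cut k n (cut l d (f (n ∸ k) (d ∸ l)))
  sh-cut (suc k) l f zero d = refl
  sh-cut (suc k) l f (suc n) d = sh-cut k l f n d
  sh-cut zero (suc l) f n zero = refl
  sh-cut zero (suc l) f n (suc d) = sh-cut zero l f n d
  sh-cut zero zero f n d = refl

  sumTo-cong : ∀ n (h h' : ℕ → ℤ) → (∀ k → k ≤ℕ n → h k ≡ h' k) → sumTo n h ≡ sumTo n h'
  sumTo-cong zero h h' e = e 0 z≤n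
  sumTo-cong (suc n) h h' e =
    cong₂ _+_ (sumTo-cong n h h' (λ k k≤n → e k (ℕP.m≤n⇒m≤1+n k≤n))) (e (suc n) ℕP.≤-refl)

  sumTo-first : ∀ n h → sumTo (suc n) h ≡ h 0 + sumTo n (λ k → h (suc k))
  sumTo-first zero h = refl
  sumTo-first (suc n) h = begin
    sumTo (suc n) h + h (suc (suc n))                        ≡⟨ cong (_+ h (suc (suc n))) (sumTo-first n h) ⟩
    (h 0 + sumTo n (λ k → h (suc k))) + h (suc (suc n))     ≡⟨ ℤP.+-assoc (h 0) _ _ ⟩
    h 0 + sumTo (suc n) (λ k → h (suc k))                   ∎
    where open ≡-Reasoning

  sumTo-reverse : ∀ n h → sumTo n h ≡ sumTo n (λ k → h (n ∸ k))
  sumTo-reverse zero h = refl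
  sumTo-reverse (suc n) h = begin
    sumTo n h + h (suc n)                       ≡⟨ cong (_+ h (suc n)) (sumTo-reverse n h) ⟩
    sumTo n (λ k → h (n ∸ k)) + h (suc n)       ≡⟨ ℤP.+-comm _ (h (suc n)) ⟩
    h (suc n) + sumTo n (λ k → h (n ∸ k))       ≡⟨ sym (sumTo-first n (λ k → h (suc n ∸ k))) ⟩
    sumTo (suc n) (λ k → h (suc n ∸ k))         ∎
    where open ≡-Reasoning

  sumTo-vanishing-tail : ∀ a b (h : ℕ → ℤ) → (∀ k → a <ℕ k → k ≤ℕ b → h k ≡ + 0) → a ≤ℕ b →
    sumTo b h ≡ sumTo a h
  sumTo-vanishing-tail a zero h z z≤n = refl
  sumTo-vanishing-tail a (suc b) h z a≤b with ℕP.m≤n⇒m<n∨m≡n a≤b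
  ... | inj₂ refl = refl
  ... | inj₁ a<1+b = begin
    sumTo b h + h (suc b)   ≡⟨ cong (λ t → sumTo b h + t) (z (suc b) a<1+b ℕP.≤-refl) ⟩
    sumTo b h + + 0         ≡⟨ ℤP.+-identityʳ _ ⟩
    sumTo b h               ≡⟨ sumTo-vanishing-tail a b h (λ k a<k k≤b → z k a<k (ℕP.m≤n⇒m≤1+n k≤b)) (ℕP.≤-pred a<1+b) ⟩
    sumTo a h               ∎
    where open ≡-Reasoning

  sumTo-truncate : ∀ m n (h : ℕ → ℤ) → (∀ k → m <ℕ k → h k ≡ + 0) →
    sumTo n h ≡ sumTo m (λ k → cut k n (h k))
  sumTo-truncate m n h z with ℕP.≤-total n m
  ... | inj₁ n≤m = begin
    sumTo n h                        ≡⟨ sumTo-cong n _ _ (λ k k≤n → sym (cut-≤ k n (h k) k≤n)) ⟩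
    sumTo n (λ k → cut k n (h k))    ≡⟨ sym (sumTo-vanishing-tail n m _ (λ k n<k _ → cut-> k n (h k) n<k) n≤m) ⟩
    sumTo m (λ k → cut k n (h k))    ∎
    where open ≡-Reasoning
  ... | inj₂ m≤n = begin
    sumTo n h                        ≡⟨ sumTo-vanishing-tail m n h (λ k m<k _ → z k m<k) m≤n ⟩
    sumTo m h                        ≡⟨ sumTo-cong m _ _ (λ k k≤m → sym (cut-≤ k n (h k) (ℕP.≤-trans k≤m m≤n))) ⟩
    sumTo m (λ k → cut k n (h k))    ∎
    where open ≡-Reasoning

  sumTo-zero : ∀ m → sumTo m (λ _ → + 0) ≡ + 0
  sumTo-zero zero = refl
  sumTo-zero (suc m) = cong (_+ + 0) (sumTo-zero m)

  cut-sumTo : ∀ k n m h → cut k n (sumTo m h) ≡ sumTo m (λ l → cut k n (h l))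
  cut-sumTo k n zero h = refl
  cut-sumTo k n (suc m) h = trans (cut-+ k n (sumTo m h) (h (suc m))) (cong (_+ cut k n (h (suc m))) (cut-sumTo k n m h))

  cut-shift : ∀ k l c (f : Series) n d → cut k n (cut l d (c * f (n ∸ k) (d ∸ l))) ≡ c * sh k l f n d
  cut-shift k l c f n d = begin
    cut k n (cut l d (c * f (n ∸ k) (d ∸ l)))   ≡⟨ cong (cut k n) (cut-* l d c _) ⟩
    cut k n (c * cut l d (f (n ∸ k) (d ∸ l)))   ≡⟨ cut-* k n c _ ⟩
    c * cut k n (cut l d (f (n ∸ k) (d ∸ l)))   ≡⟨ cong (c *_) (sym (sh-cut k l f n d)) ⟩
    c * sh k l f n d                            ∎
    where open ≡-Reasoning

  IsPolynomial : ℕ → ℕ → Series → Set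
  IsPolynomial a b g = (∀ k l → a <ℕ k → g k l ≡ + 0) × (∀ k l → b <ℕ l → g k l ≡ + 0)

  ⋆-polynomial : ∀ a b (g : Series) → IsPolynomial a b g → ∀ (f : Series) n d →
    (f ⋆ g) n d ≡ sumTo a (λ k → sumTo b (λ l → g k l * sh k l f n d))
  ⋆-polynomial a b g (g-x-deg , g-q-deg) f n d = begin
    sumTo n (λ i → sumTo d (λ j → f i j * g (n ∸ i) (d ∸ j)))
      ≡⟨ sumTo-reverse n _ ⟩
    sumTo n (λ k → sumTo d (λ j → f (n ∸ k) j * g (n ∸ (n ∸ k)) (d ∸ j)))
      ≡⟨ sumTo-cong n _ _ column-truncated ⟩
    sumTo n column
      ≡⟨ sumTo-truncate a n column column-vanishes ⟩
    sumTo a (λ k → cut k n (column k))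
      ≡⟨ sumTo-cong a _ _ (λ k _ → trans (cut-sumTo k n b _) (sumTo-cong b _ _ (λ l _ → cut-shift k l (g k l) f n d))) ⟩
    sumTo a (λ k → sumTo b (λ l → g k l * sh k l f n d)) ∎
    where
    open ≡-Reasoning
    column : ℕ → ℤ
    column k = sumTo b (λ l → cut l d (g k l * f (n ∸ k) (d ∸ l)))

    column-truncated : ∀ k → k ≤ℕ n →
      sumTo d (λ j → f (n ∸ k) j * g (n ∸ (n ∸ k)) (d ∸ j)) ≡ column k
    column-truncated k k≤n = begin
      sumTo d (λ j → f (n ∸ k) j * g (n ∸ (n ∸ k)) (d ∸ j))
        ≡⟨ cong (λ t → sumTo d (λ j → f (n ∸ k) j * g t (d ∸ j))) (ℕP.m∸[m∸n]≡n k≤n) ⟩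
      sumTo d (λ j → f (n ∸ k) j * g k (d ∸ j))
        ≡⟨ sumTo-reverse d _ ⟩
      sumTo d (λ l → f (n ∸ k) (d ∸ l) * g k (d ∸ (d ∸ l)))
        ≡⟨ sumTo-cong d _ _ (λ l l≤d → trans (cong (λ t → f (n ∸ k) (d ∸ l) * g k t) (ℕP.m∸[m∸n]≡n l≤d))
                                              (ℤP.*-comm (f (n ∸ k) (d ∸ l)) (g k l))) ⟩
      sumTo d (λ l → g k l * f (n ∸ k) (d ∸ l))
        ≡⟨ sumTo-truncate b d _ (λ l b<l → trans (cong (_* f (n ∸ k) (d ∸ l)) (g-q-deg k l b<l))
                                                (ℤP.*-zeroˡ (f (n ∸ k) (d ∸ l)))) ⟩
      column k ∎

    column-vanishes : ∀ k → a <ℕ k → column k ≡ + 0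
    column-vanishes k a<k = trans (sumTo-cong b _ _ (λ l _ → vanish l)) (sumTo-zero b)
      where
      vanish : ∀ l → cut l d (g k l * f (n ∸ k) (d ∸ l)) ≡ + 0
      vanish l = trans (cut-* l d (g k l) _)
                       (trans (cong (_* cut l d (f (n ∸ k) (d ∸ l))) (g-x-deg k l a<k)) (ℤP.*-zeroˡ (cut l d (f (n ∸ k) (d ∸ l)))))

  cancel-1-x : ∀ (g : Series) → (∀ n d → g n d - sh 1 0 g n d ≡ + 0) → ∀ n d → g n d ≡ + 0
  cancel-1-x g h zero d = trans (sym (ℤP.+-identityʳ (g 0 d))) (h 0 d)
  cancel-1-x g h (suc n) d = begin
    g (suc n) d                       ≡⟨ difference-plus (g (suc n) d) (g n d) ⟩
    (g (suc n) d - g n d) + g n d     ≡⟨ cong₂ _+_ (h (suc n) d) (cancel-1-x g h n d) ⟩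
    + 0                               ∎
    where
    open ≡-Reasoning
    difference-plus : ∀ a b → a ≡ (a - b) + b
    difference-plus = solve-∀

-- Finite ℤ-linear combinations of monomial shifts xⁱqʲ⟦b⟧ of a family of
-- series ⟦_⟧ indexed by a type of names with decidable equality.  An
-- identity between such combinations that holds formally (after
-- collecting like monomials) holds coefficientwise; this is how the
-- elimination certificate of the main theorem is checked.
module LinearCombinations {Name : Set} (_≟_ : DecidableEquality Name) (⟦_⟧ : Name → Series) where

  open import Defs
  open Series
  open import Data.Nat as ℕ using (ℕ; zero; suc) renaming (_+_ to _+ℕ_)
  open import Data.Integer using (ℤ; +_; _+_; _*_; -1ℤ)
  import Data.Integer.Properties as ℤP
  open import Data.Integer.Tactic.RingSolver using (solve-∀)
  open import Data.Bool using (Bool; true; false)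
  open import Data.List using (List; []; _∷_; _++_; map; concatMap)
  open import Data.Product using (_×_; _,_)
  import Data.Product.Properties as ×P
  open import Relation.Nullary using (yes; no)
  open import Relation.Binary.PropositionalEquality


  Monomial : Set
  Monomial = ℕ × ℕ × Name

  _≟ₘ_ : DecidableEquality Monomial
  _≟ₘ_ = ×P.≡-dec ℕ._≟_ (×P.≡-dec ℕ._≟_ _≟_)

  ⟦_⟧ₘ : Monomial → Series
  ⟦ i , j , b ⟧ₘ = sh i j ⟦ b ⟧

  record Term : Set where
    constructor _·_
    field
      coeff : ℤ
      monomial : Monomial
  open Term

  infix 5 _·_

  lin : List Term → Series
  lin [] n d = + 0
  lin ((c · m) ∷ ts) n d = c * ⟦ m ⟧ₘ n d + lin ts n d

  lin-++ : ∀ ts us n d → lin (ts ++ us) n d ≡ lin ts n d + lin us n d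
  lin-++ [] us n d = sym (ℤP.+-identityˡ _)
  lin-++ ((c · m) ∷ ts) us n d = trans (cong (_+_ (c * ⟦ m ⟧ₘ n d)) (lin-++ ts us n d)) (sym (ℤP.+-assoc (c * ⟦ m ⟧ₘ n d) (lin ts n d) (lin us n d)))

  scale : ℤ → List Term → List Term
  scale a = map (λ t → (a * coeff t) · monomial t)

  lin-scale : ∀ a ts n d → lin (scale a ts) n d ≡ a * lin ts n d
  lin-scale a [] n d = sym (ℤP.*-zeroʳ a)
  lin-scale a ((c · m) ∷ ts) n d = trans (cong (_+_ (a * c * ⟦ m ⟧ₘ n d)) (lin-scale a ts n d)) (distrib a c (⟦ m ⟧ₘ n d) (lin ts n d))
    where
    distrib : ∀ a c v w → a * c * v + a * w ≡ a * (c * v + w)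
    distrib = solve-∀

  shift : ℕ → ℕ → List Term → List Term
  shift i j = map (λ { (c · (α , β , b)) → c · (i +ℕ α , j +ℕ β , b) })

  lin-shift : ∀ i j ts n d → sh i j (lin ts) n d ≡ lin (shift i j ts) n d
  lin-shift i j [] n d = sh-𝟘 i j n d
  lin-shift i j ((c · (α , β , b)) ∷ ts) n d = begin
    sh i j (lin ((c · (α , β , b)) ∷ ts)) n d
      ≡⟨ sh-pointwise i j (λ u v → c * u + v) (trans (ℤP.+-identityʳ _) (ℤP.*-zeroʳ c)) (sh α β ⟦ b ⟧) (lin ts) n d ⟩
    c * sh i j (sh α β ⟦ b ⟧) n d + sh i j (lin ts) n d
      ≡⟨ cong₂ (λ u v → c * u + v) (sh-sh i j α β ⟦ b ⟧ n d) (lin-shift i j ts n d) ⟩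
    lin (shift i j ((c · (α , β , b)) ∷ ts)) n d ∎
    where open ≡-Reasoning

  insert : Term → List Term → List Term
  insert t [] = t ∷ []
  insert (c · m) ((c' · m') ∷ us) with m ≟ₘ m'
  ... | yes _ = (c + c' · m') ∷ us
  ... | no _ = (c' · m') ∷ insert (c · m) us

  lin-insert : ∀ t us n d → lin (insert t us) n d ≡ lin (t ∷ us) n d
  lin-insert (c · m) [] n d = refl
  lin-insert (c · m) ((c' · m') ∷ us) n d with m ≟ₘ m'
  ... | yes refl = merge c c' (⟦ m ⟧ₘ n d) (lin us n d)
    where
    merge : ∀ c c' v w → (c + c') * v + w ≡ c * v + (c' * v + w)
    merge = solve-∀
  ... | no _ = trans (cong (_+_ (c' * ⟦ m' ⟧ₘ n d)) (lin-insert (c · m) us n d))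
                     (swap (c * ⟦ m ⟧ₘ n d) (c' * ⟦ m' ⟧ₘ n d) (lin us n d))
    where
    swap : ∀ u v w → v + (u + w) ≡ u + (v + w)
    swap = solve-∀

  collect : List Term → List Term
  collect [] = []
  collect (t ∷ ts) = insert t (collect ts)

  lin-collect : ∀ ts n d → lin (collect ts) n d ≡ lin ts n d
  lin-collect [] n d = refl
  lin-collect (t ∷ ts) n d =
    trans (lin-insert t (collect ts) n d) (cong (_+_ (coeff t * ⟦ monomial t ⟧ₘ n d)) (lin-collect ts n d))

  termsTo : ℕ → (ℕ → List Term) → List Term
  termsTo zero h = h 0
  termsTo (suc m) h = termsTo m h ++ h (suc m)

  lin-termsTo : ∀ m h n d → lin (termsTo m h) n d ≡ sumTo m (λ k → lin (h k) n d)
  lin-termsTo zero h n d = refl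
  lin-termsTo (suc m) h n d =
    trans (lin-++ (termsTo m h) (h (suc m)) n d) (cong (λ v → v + lin (h (suc m)) n d) (lin-termsTo m h n d))

  polynomialTimes : ℕ → ℕ → Series → Name → List Term
  polynomialTimes a c g b = termsTo a (λ k → termsTo c (λ l → (g k l · (k , l , b)) ∷ []))

  lin-polynomialTimes : ∀ a c g b n d →
    lin (polynomialTimes a c g b) n d ≡ sumTo a (λ k → sumTo c (λ l → g k l * sh k l ⟦ b ⟧ n d))
  lin-polynomialTimes a c g b n d =
    trans (lin-termsTo a _ n d) (sumTo-cong a _ _ λ k _ →
      trans (lin-termsTo c _ n d) (sumTo-cong c _ _ λ l _ → ℤP.+-identityʳ _))

  Vanishes : List Term → Set
  Vanishes R = ∀ n d → lin R n d ≡ + 0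

  _≔_ : Name → List Term → List Term
  b ≔ rhs = (+ 1 · (0 , 0 , b)) ∷ scale -1ℤ rhs

  ≔-vanishes : ∀ b rhs → (∀ n d → ⟦ b ⟧ n d ≡ lin rhs n d) → Vanishes (b ≔ rhs)
  ≔-vanishes b rhs equation n d = begin
    + 1 * ⟦ b ⟧ n d + lin (scale -1ℤ rhs) n d   ≡⟨ cong₂ (λ u v → + 1 * u + v) (equation n d) (lin-scale -1ℤ rhs n d) ⟩
    + 1 * lin rhs n d + -1ℤ * lin rhs n d       ≡⟨ cancel (lin rhs n d) ⟩
    + 0                                         ∎
    where
    open ≡-Reasoning
    cancel : ∀ w → + 1 * w + -1ℤ * w ≡ + 0
    cancel = solve-∀

  allZero : List Term → Bool
  allZero [] = true
  allZero ((+ 0 · _) ∷ ts) = allZero ts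
  allZero (_ ∷ ts) = false

  lin-allZero : ∀ ts → allZero ts ≡ true → ∀ n d → lin ts n d ≡ + 0
  lin-allZero [] _ n d = refl
  lin-allZero ((+ 0 · m) ∷ ts) z n d = cong₂ _+_ (ℤP.*-zeroˡ (⟦ m ⟧ₘ n d)) (lin-allZero ts z n d)

  -- Given a family of vanishing combinations (relations), a certificate
  -- is a list of relations, each with a multiplier a xⁱqʲ.
  module _ {Rel : Set} (relation : Rel → List Term) (relation-vanishes : ∀ r → Vanishes (relation r)) where

    combination : List (ℤ × ℕ × ℕ × Rel) → List Term
    combination = concatMap (λ { (a , i , j , r) → scale a (shift i j (relation r)) })

    combination-vanishes : ∀ cs → Vanishes (combination cs)
    combination-vanishes [] n d = refl
    combination-vanishes ((a , i , j , r) ∷ cs) n d = begin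
      lin (scale a (shift i j (relation r)) ++ combination cs) n d
        ≡⟨ lin-++ (scale a (shift i j (relation r))) (combination cs) n d ⟩
      lin (scale a (shift i j (relation r))) n d + lin (combination cs) n d
        ≡⟨ cong₂ _+_ (lin-scale a (shift i j (relation r)) n d) (combination-vanishes cs n d) ⟩
      a * lin (shift i j (relation r)) n d + + 0
        ≡⟨ cong (λ v → a * v + + 0) (sym (lin-shift i j (relation r) n d)) ⟩
      a * sh i j (lin (relation r)) n d + + 0
        ≡⟨ cong (λ v → a * v + + 0) (trans (sh-cong i j (relation-vanishes r) n d) (sh-𝟘 i j n d)) ⟩
      a * + 0 + + 0
        ≡⟨ cong (_+ + 0) (ℤP.*-zeroʳ a) ⟩
      + 0 ∎
      where open ≡-Reasoning

    certified : ∀ ts cs → allZero (collect (ts ++ combination cs)) ≡ true → Vanishes ts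
    certified ts cs cancels n d = begin
      lin ts n d                                    ≡⟨ sym (ℤP.+-identityʳ _) ⟩
      lin ts n d + + 0                              ≡⟨ cong (_+_ (lin ts n d)) (sym (combination-vanishes cs n d)) ⟩
      lin ts n d + lin (combination cs) n d         ≡⟨ sym (lin-++ ts (combination cs) n d) ⟩
      lin (ts ++ combination cs) n d                ≡⟨ sym (lin-collect (ts ++ combination cs) n d) ⟩
      lin (collect (ts ++ combination cs)) n d      ≡⟨ lin-allZero (collect (ts ++ combination cs)) cancels n d ⟩
      + 0                                           ∎
      where open ≡-Reasoning

module Transfer where

  open import Defs
  open Series
  open import Data.Nat as ℕ using (ℕ; zero; suc; s≤s) renaming (_+_ to _+ℕ_)
  open import Data.Integer using (ℤ; +_; _+_; _*_; _-_; -[1+_]; -_; -1ℤ)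
  import Data.Integer.Properties as ℤP
  import Data.Nat.Properties as ℕP
  open import Data.Integer.Tactic.RingSolver using (solve-∀)
  open import Data.Bool using (Bool; true; false; if_then_else_; _∧_)
  open import Data.Fin as Fin using (Fin)
  open import Data.List using (List; []; _∷_; _++_)
  open import Data.Product using (_×_; _,_)
  open import Relation.Nullary.Decidable using (map′)
  open import Relation.Binary.Definitions using (DecidableEquality)
  open import Relation.Binary.PropositionalEquality

  -- Ways n r cur prev is the number
  -- of ways to place n further elements when the current column is k ≥ 1,
  -- r further columns remain to be opened, and cur / prev record whether
  -- rows k / k - 1 are occupied already.  The next element goes on the
  -- diagonal of column k (occupying row k), on its superdiagonal (occupying
  -- row k - 1), or, provided row k - 1 is occupied (no later element can
  -- reach it), it opens column k + 1.
  mutual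
    Ways : ℕ → ℕ → Bool → Bool → ℕ
    Ways zero zero cur prev = if cur ∧ prev then 1 else 0
    Ways zero (suc r) cur prev = 0
    Ways (suc n) r cur prev = Ways n r true prev +ℕ Ways n r cur true +ℕ (if prev then Opening n r cur else 0)

    Opening : ℕ → ℕ → Bool → ℕ
    Opening n zero cur = 0
    Opening n (suc r) cur = Ways n r true cur +ℕ Ways n r false true

  -- In column 0 there is no superdiagonal and no row -1.
  Ways₀ : ℕ → ℕ → ℕ
  Ways₀ zero zero = 1
  Ways₀ zero (suc r) = 0
  Ways₀ (suc n) r = Ways₀ n r +ℕ Opening n r true

  -- The number of bidiagonal partition matrices of size n and dimension d:
  -- the first element necessarily opens column 0 on the diagonal.
  bidiagonalCount : ℕ → ℕ → ℕ
  bidiagonalCount zero zero = 1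
  bidiagonalCount zero (suc d) = 0
  bidiagonalCount (suc n) zero = 0
  bidiagonalCount (suc n) (suc d) = Ways₀ n d

  Z A B C : Series
  Z n r = + Ways₀ n r
  A n r = + Ways n r true true
  B n r = + Ways n r false true
  C n r = + Ways n r true false

  data Name : Set where
    `F `Z `A `B `C `1 : Name

  private
    index : Name → Fin 6
    index `F = Fin.zero
    index `Z = Fin.suc Fin.zero
    index `A = Fin.suc (Fin.suc Fin.zero)
    index `B = Fin.suc (Fin.suc (Fin.suc Fin.zero))
    index `C = Fin.suc (Fin.suc (Fin.suc (Fin.suc Fin.zero)))
    index `1 = Fin.suc (Fin.suc (Fin.suc (Fin.suc (Fin.suc Fin.zero))))

    index-injective : ∀ {a b} → index a ≡ index b → a ≡ b
    index-injective {`F} {`F} _ = refl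
    index-injective {`Z} {`Z} _ = refl
    index-injective {`A} {`A} _ = refl
    index-injective {`B} {`B} _ = refl
    index-injective {`C} {`C} _ = refl
    index-injective {`1} {`1} _ = refl

  _≟ₙ_ : DecidableEquality Name
  a ≟ₙ b = map′ index-injective (cong index) (index a Fin.≟ index b)

  basis : Series → Name → Series
  basis F `F = F
  basis F `Z = Z
  basis F `A = A
  basis F `B = B
  basis F `C = C
  basis F `1 = δ

  opening-ℤ : ∀ m e cur → + Opening m e cur ≡ sh 0 1 (λ m e → + Ways m e true cur) m e + sh 0 1 B m e
  opening-ℤ m zero cur = refl
  opening-ℤ m (suc e) cur = ℤP.pos-+ (Ways m e true cur) (Ways m e false true)

  Z-step : ∀ m e → Z (suc m) e ≡ Z m e + (sh 0 1 A m e + sh 0 1 B m e)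
  Z-step m e = trans (ℤP.pos-+ (Ways₀ m e) (Opening m e true)) (cong (_+_ (Z m e)) (opening-ℤ m e true))

  A-step : ∀ m e → A (suc m) e ≡ (A m e + A m e) + (sh 0 1 A m e + sh 0 1 B m e)
  A-step m e = begin
    + (Ways m e true true +ℕ Ways m e true true +ℕ Opening m e true)
      ≡⟨ ℤP.pos-+ (Ways m e true true +ℕ Ways m e true true) (Opening m e true) ⟩
    + (Ways m e true true +ℕ Ways m e true true) + + Opening m e true
      ≡⟨ cong₂ _+_ (ℤP.pos-+ (Ways m e true true) (Ways m e true true)) (opening-ℤ m e true) ⟩
    (A m e + A m e) + (sh 0 1 A m e + sh 0 1 B m e) ∎
    where open ≡-Reasoning

  B-step : ∀ m e → B (suc m) e ≡ (A m e + B m e) + (sh 0 1 C m e + sh 0 1 B m e)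
  B-step m e = begin
    + (Ways m e true true +ℕ Ways m e false true +ℕ Opening m e false)
      ≡⟨ ℤP.pos-+ (Ways m e true true +ℕ Ways m e false true) (Opening m e false) ⟩
    + (Ways m e true true +ℕ Ways m e false true) + + Opening m e false
      ≡⟨ cong₂ _+_ (ℤP.pos-+ (Ways m e true true) (Ways m e false true)) (opening-ℤ m e false) ⟩
    (A m e + B m e) + (sh 0 1 C m e + sh 0 1 B m e) ∎
    where open ≡-Reasoning

  C-step : ∀ m e → C (suc m) e ≡ C m e + A m e
  C-step m e = begin
    + (Ways m e true false +ℕ Ways m e true true +ℕ 0)
      ≡⟨ cong +_ (ℕP.+-identityʳ (Ways m e true false +ℕ Ways m e true true)) ⟩
    + (Ways m e true false +ℕ Ways m e true true)
      ≡⟨ ℤP.pos-+ (Ways m e true false) (Ways m e true true) ⟩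
    C m e + A m e ∎
    where open ≡-Reasoning

  module Elimination (F : Series) (F-equation : ∀ n d → F n d ≡ δ n d + sh 1 1 Z n d) where
    open LinearCombinations _≟ₙ_ (basis F)

    -- The equations as combinations:  F = 1 + xqZ,
    --   Z = 1 + xZ + xqA + xqB,    A = 1 + 2xA + xqA + xqB,
    --   B = xA + xB + xqC + xqB,   C = xC + xA.
    F-rhs Z-rhs A-rhs B-rhs C-rhs : List Term
    F-rhs = (+ 1 · (0 , 0 , `1)) ∷ (+ 1 · (1 , 1 , `Z)) ∷ []
    Z-rhs = (+ 1 · (0 , 0 , `1)) ∷ (+ 1 · (1 , 0 , `Z)) ∷ (+ 1 · (1 , 1 , `A)) ∷ (+ 1 · (1 , 1 , `B)) ∷ []
    A-rhs = (+ 1 · (0 , 0 , `1)) ∷ (+ 2 · (1 , 0 , `A)) ∷ (+ 1 · (1 , 1 , `A)) ∷ (+ 1 · (1 , 1 , `B)) ∷ []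
    B-rhs = (+ 1 · (1 , 0 , `A)) ∷ (+ 1 · (1 , 0 , `B)) ∷ (+ 1 · (1 , 1 , `C)) ∷ (+ 1 · (1 , 1 , `B)) ∷ []
    C-rhs = (+ 1 · (1 , 0 , `C)) ∷ (+ 1 · (1 , 0 , `A)) ∷ []

    Z-equation : ∀ n d → Z n d ≡ lin Z-rhs n d
    Z-equation zero zero = refl
    Z-equation zero (suc d) = refl
    Z-equation (suc m) e = trans (Z-step m e) (tidy (Z m e) (sh 0 1 A m e) (sh 0 1 B m e))
      where
      tidy : ∀ z a b → z + (a + b) ≡ + 1 * + 0 + (+ 1 * z + (+ 1 * a + (+ 1 * b + + 0)))
      tidy = solve-∀

    A-equation : ∀ n d → A n d ≡ lin A-rhs n d
    A-equation zero zero = refl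
    A-equation zero (suc d) = refl
    A-equation (suc m) e = trans (A-step m e) (tidy (A m e) (sh 0 1 A m e) (sh 0 1 B m e))
      where
      tidy : ∀ a a' b' → (a + a) + (a' + b') ≡ + 1 * + 0 + (+ 2 * a + (+ 1 * a' + (+ 1 * b' + + 0)))
      tidy = solve-∀

    B-equation : ∀ n d → B n d ≡ lin B-rhs n d
    B-equation zero zero = refl
    B-equation zero (suc d) = refl
    B-equation (suc m) e = trans (B-step m e) (tidy (A m e) (B m e) (sh 0 1 C m e) (sh 0 1 B m e))
      where
      tidy : ∀ a b c' b' → (a + b) + (c' + b') ≡ + 1 * a + (+ 1 * b + (+ 1 * c' + (+ 1 * b' + + 0)))
      tidy = solve-∀

    C-equation : ∀ n d → C n d ≡ lin C-rhs n d
    C-equation zero zero = refl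
    C-equation zero (suc d) = refl
    C-equation (suc m) e = trans (C-step m e) (tidy (C m e) (A m e))
      where
      tidy : ∀ c a → c + a ≡ + 1 * c + (+ 1 * a + + 0)
      tidy = solve-∀

    relation : Name → List Term
    relation `F = `F ≔ F-rhs
    relation `Z = `Z ≔ Z-rhs
    relation `A = `A ≔ A-rhs
    relation `B = `B ≔ B-rhs
    relation `C = `C ≔ C-rhs
    relation `1 = []

    relation-vanishes : ∀ b → Vanishes (relation b)
    relation-vanishes `F = ≔-vanishes `F F-rhs λ n d →
      trans (F-equation n d) (tidy (δ n d) (sh 1 1 Z n d))
      where
      tidy : ∀ u z → u + z ≡ + 1 * u + (+ 1 * z + + 0)
      tidy = solve-∀
    relation-vanishes `Z = ≔-vanishes `Z Z-rhs Z-equation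
    relation-vanishes `A = ≔-vanishes `A A-rhs A-equation
    relation-vanishes `B = ≔-vanishes `B B-rhs B-equation
    relation-vanishes `C = ≔-vanishes `C C-rhs C-equation
    relation-vanishes `1 n d = refl

    residual : List Term
    residual = polynomialTimes 3 2 denom `F ++ scale -1ℤ (polynomialTimes 3 1 numer `1)

    residual₁ : List Term
    residual₁ = residual ++ scale -1ℤ (shift 1 0 residual)

    certificate : List (ℤ × ℕ × ℕ × Name)
    certificate =
      (+ 1 , 0 , 0 , `F) ∷
      (-[1+ 4 ] , 1 , 0 , `F) ∷
      (-[1+ 1 ] , 1 , 1 , `F) ∷
      (+ 9 , 2 , 0 , `F) ∷
      (+ 6 , 2 , 1 , `F) ∷
      (+ 1 , 2 , 2 , `F) ∷
      (-[1+ 6 ] , 3 , 0 , `F) ∷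
      (-[1+ 5 ] , 3 , 1 , `F) ∷
      (-[1+ 2 ] , 3 , 2 , `F) ∷
      (+ 2 , 4 , 0 , `F) ∷
      (+ 2 , 4 , 1 , `F) ∷
      (+ 2 , 4 , 2 , `F) ∷
      (+ 1 , 1 , 1 , `Z) ∷
      (-[1+ 3 ] , 2 , 1 , `Z) ∷
      (-[1+ 1 ] , 2 , 2 , `Z) ∷
      (+ 5 , 3 , 1 , `Z) ∷
      (+ 4 , 3 , 2 , `Z) ∷
      (+ 1 , 3 , 3 , `Z) ∷
      (-[1+ 1 ] , 4 , 1 , `Z) ∷
      (-[1+ 1 ] , 4 , 2 , `Z) ∷
      (-[1+ 1 ] , 4 , 3 , `Z) ∷
      (+ 1 , 2 , 2 , `A) ∷
      (-[1+ 0 ] , 3 , 2 , `A) ∷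
      (-[1+ 0 ] , 3 , 3 , `A) ∷
      (+ 2 , 4 , 3 , `A) ∷
      (+ 1 , 2 , 2 , `B) ∷
      (-[1+ 2 ] , 3 , 2 , `B) ∷
      (+ 2 , 4 , 2 , `B) ∷
      (+ 1 , 3 , 3 , `C) ∷
      (-[1+ 1 ] , 4 , 3 , `C) ∷ []

    residual₁-vanishes : Vanishes residual₁
    residual₁-vanishes = certified relation relation-vanishes residual₁ certificate refl

    denom-polynomial : IsPolynomial 3 2 denom
    denom-polynomial = x-degree , q-degree
      where
      x-degree : ∀ k l → 3 ℕ.< k → denom k l ≡ + 0
      x-degree (suc (suc (suc (suc k)))) l (s≤s (s≤s (s≤s (s≤s _)))) = refl
      q-degree : ∀ k l → 2 ℕ.< l → denom k l ≡ + 0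
      q-degree 0 (suc (suc (suc l))) (s≤s (s≤s (s≤s _))) = refl
      q-degree 1 (suc (suc (suc l))) (s≤s (s≤s (s≤s _))) = refl
      q-degree 2 (suc (suc (suc l))) (s≤s (s≤s (s≤s _))) = refl
      q-degree 3 (suc (suc (suc l))) (s≤s (s≤s (s≤s _))) = refl
      q-degree (suc (suc (suc (suc k)))) (suc (suc (suc l))) (s≤s (s≤s (s≤s _))) = refl

    numer-expansion : ∀ n d → numer n d ≡ lin (polynomialTimes 3 1 numer `1) n d
    numer-expansion 0 0 = refl
    numer-expansion 0 1 = refl
    numer-expansion 0 (suc (suc d)) = refl
    numer-expansion 1 0 = refl
    numer-expansion 1 1 = refl
    numer-expansion 1 (suc (suc d)) = refl
    numer-expansion 2 0 = refl
    numer-expansion 2 1 = refl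
    numer-expansion 2 (suc (suc d)) = refl
    numer-expansion 3 0 = refl
    numer-expansion 3 1 = refl
    numer-expansion 3 (suc (suc d)) = refl
    numer-expansion (suc (suc (suc (suc n)))) 0 = refl
    numer-expansion (suc (suc (suc (suc n)))) 1 = refl
    numer-expansion (suc (suc (suc (suc n)))) (suc (suc d)) = refl

    E : Series
    E n d = (F ⋆ denom) n d - numer n d

    E-value : ∀ n d → E n d ≡ lin residual n d
    E-value n d = begin
      (F ⋆ denom) n d - numer n d
        ≡⟨ cong₂ _-_ (⋆-polynomial 3 2 denom denom-polynomial F n d) (numer-expansion n d) ⟩
      sumTo 3 (λ k → sumTo 2 (λ l → denom k l * sh k l F n d)) - lin numerTerms n d
        ≡⟨ cong₂ _-_ (sym (lin-polynomialTimes 3 2 denom `F n d)) refl ⟩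
      lin denomTerms n d - lin numerTerms n d
        ≡⟨ cong (_+_ (lin denomTerms n d)) (sym (trans (lin-scale -1ℤ numerTerms n d) (ℤP.-1*i≡-i _))) ⟩
      lin denomTerms n d + lin (scale -1ℤ numerTerms) n d
        ≡⟨ sym (lin-++ denomTerms (scale -1ℤ numerTerms) n d) ⟩
      lin residual n d ∎
      where
      open ≡-Reasoning
      denomTerms = polynomialTimes 3 2 denom `F
      numerTerms = polynomialTimes 3 1 numer `1

    E₁-value : ∀ n d → E n d - sh 1 0 E n d ≡ lin residual₁ n d
    E₁-value n d = begin
      E n d - sh 1 0 E n d
        ≡⟨ cong₂ _-_ (E-value n d) (trans (sh-cong 1 0 E-value n d) (lin-shift 1 0 residual n d)) ⟩
      lin residual n d - lin (shift 1 0 residual) n d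
        ≡⟨ cong (_+_ (lin residual n d)) (sym (trans (lin-scale -1ℤ (shift 1 0 residual) n d) (ℤP.-1*i≡-i _))) ⟩
      lin residual n d + lin (scale -1ℤ (shift 1 0 residual)) n d
        ≡⟨ sym (lin-++ residual (scale -1ℤ (shift 1 0 residual)) n d) ⟩
      lin residual₁ n d ∎
      where open ≡-Reasoning

    F-rational : ∀ n d → (F ⋆ denom) n d ≡ numer n d
    F-rational n d = begin
      (F ⋆ denom) n d                        ≡⟨ difference-plus ((F ⋆ denom) n d) (numer n d) ⟩
      E n d + numer n d                      ≡⟨ cong (_+ numer n d) (cancel-1-x E (λ m e → trans (E₁-value m e) (residual₁-vanishes m e)) n d) ⟩
      + 0 + numer n d                        ≡⟨ ℤP.+-identityˡ (numer n d) ⟩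
      numer n d                              ∎
      where
      open ≡-Reasoning
      difference-plus : ∀ a b → a ≡ (a - b) + b
      difference-plus = solve-∀

module Enumeration where

  open import Defs
  open import Data.Nat as ℕ using (ℕ; zero; suc; _+_; _≤_; z≤n; s≤s)
  import Data.Nat.Properties as ℕP
  open import Data.Bool using (Bool; true; false)
  import Data.Bool as Bool
  open import Data.Fin as Fin using (Fin)
  open import Data.Vec using (Vec; []; _∷_; lookup)
  import Data.Vec.Properties as VecP
  open import Data.List using (List; []; _∷_; map; concatMap; _++_; length; filter; tabulate)
  import Data.List.Properties as ListP
  open import Data.List.Membership.Propositional using (_∈_)
  open import Data.List.Membership.Propositional.Properties
    using (∈-map⁺; ∈-map⁻; ∈-concatMap⁺; ∈-concatMap⁻; ∈-++⁻; ∈-++⁺ˡ; ∈-++⁺ʳ; ∈-filter⁺; ∈-filter⁻)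
  open import Data.List.Membership.Propositional.Properties.WithK using (unique∧set⇒bag)
  open import Data.List.Relation.Unary.Any as Any using (here; there)
  open import Data.List.Relation.Unary.All as All using (All; []; _∷_)
  import Data.List.Relation.Unary.All.Properties as AllP
  open import Data.List.Relation.Unary.Unique.Propositional using (Unique; []; _∷_)
  import Data.List.Relation.Unary.Unique.Propositional.Properties as Unique
  open import Data.List.Relation.Binary.BagAndSetEquality using (∼bag⇒↭; _∼[_]_; set)
  open import Data.List.Relation.Binary.Permutation.Propositional.Properties using (↭-length)
  open import Data.Product using (_×_; _,_; proj₁; proj₂; Σ)
  open import Data.Empty using (⊥-elim)
  open import Relation.Nullary using (¬_)
  open import Function.Bundles using (mk⇔)
  open import Function.Base using (_∘_)
  open import Relation.Binary.PropositionalEquality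

  count-++ : ∀ {A : Set} (p : A → Bool) xs ys → countᵇ p (xs ++ ys) ≡ countᵇ p xs + countᵇ p ys
  count-++ p [] ys = refl
  count-++ p (x ∷ xs) ys with p x
  ... | true = cong suc (count-++ p xs ys)
  ... | false = count-++ p xs ys

  count-map : ∀ {A B : Set} (p : B → Bool) (f : A → B) xs → countᵇ p (map f xs) ≡ countᵇ (λ x → p (f x)) xs
  count-map p f [] = refl
  count-map p f (x ∷ xs) with p (f x)
  ... | true = cong suc (count-map p f xs)
  ... | false = count-map p f xs

  sumMap : ∀ {A : Set} → (A → ℕ) → List A → ℕ
  sumMap g [] = 0
  sumMap g (x ∷ xs) = g x + sumMap g xs

  sumMap-cong : ∀ {A : Set} (g g' : A → ℕ) xs → (∀ x → g x ≡ g' x) → sumMap g xs ≡ sumMap g' xs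
  sumMap-cong g g' [] e = refl
  sumMap-cong g g' (x ∷ xs) e = cong₂ _+_ (e x) (sumMap-cong g g' xs e)

  count-concatMap : ∀ {A B : Set} (p : B → Bool) (f : A → List B) xs →
    countᵇ p (concatMap f xs) ≡ sumMap (λ x → countᵇ p (f x)) xs
  count-concatMap p f [] = refl
  count-concatMap p f (x ∷ xs) =
    trans (count-++ p (f x) (concatMap f xs)) (cong (countᵇ p (f x) +_) (count-concatMap p f xs))

  count-cong : ∀ {A : Set} (p q : A → Bool) xs → (∀ y → y ∈ xs → p y ≡ q y) → countᵇ p xs ≡ countᵇ q xs
  count-cong p q [] e = refl
  count-cong p q (x ∷ xs) e rewrite e x (here refl) with q x
  ... | true = cong suc (count-cong p q xs (λ y m → e y (there m)))
  ... | false = count-cong p q xs (λ y m → e y (there m))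

  count-false : ∀ {A : Set} (p : A → Bool) xs → (∀ x → p x ≡ false) → countᵇ p xs ≡ 0
  count-false p [] z = refl
  count-false p (x ∷ xs) z rewrite z x = count-false p xs z

  count≡length-filter : ∀ {A : Set} (p : A → Bool) xs → countᵇ p xs ≡ length (filter (λ y → p y Bool.≟ true) xs)
  count≡length-filter p [] = refl
  count≡length-filter p (x ∷ xs) with p x
  ... | true = cong suc (count≡length-filter p xs)
  ... | false = count≡length-filter p xs

  count-witness : ∀ {A : Set} (p : A → Bool) xs {m} → countᵇ p xs ≡ suc m → Σ A λ a → p a ≡ true
  count-witness p (x ∷ xs) e with p x in px
  ... | true = x , px
  ... | false = count-witness p xs e

  count-member : ∀ {A : Set} (p : A → Bool) {xs a} → a ∈ xs → p a ≡ true → 1 ≤ countᵇ p xs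
  count-member p {x ∷ xs} (here refl) pa rewrite pa = s≤s z≤n
  count-member p {x ∷ xs} (there m) pa with p x
  ... | true = s≤s z≤n
  ... | false = count-member p m pa

  count-two : ∀ {A : Set} (p : A → Bool) {xs a a'} → a ∈ xs → a' ∈ xs → a ≢ a' → p a ≡ true → p a' ≡ true →
    2 ≤ countᵇ p xs
  count-two p (here refl) (here refl) a≢a' _ _ = ⊥-elim (a≢a' refl)
  count-two p (here refl) (there m') _ pa pa' rewrite pa = s≤s (count-member p m' pa')
  count-two p (there m) (here refl) a≢a' pa pa' = count-two p (here refl) (there m) (a≢a' ∘ sym) pa' pa
  count-two p {x ∷ xs} (there m) (there m') a≢a' pa pa' with p x
  ... | true = ℕP.m≤n⇒m≤1+n (count-two p m m' a≢a' pa pa')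
  ... | false = count-two p m m' a≢a' pa pa'

  unique-map : ∀ {A B : Set} (f : A → B) {xs} → Unique xs → (∀ {a b} → a ∈ xs → b ∈ xs → f a ≡ f b → a ≡ b) →
    Unique (map f xs)
  unique-map f [] inj = []
  unique-map f {x ∷ xs} (x∉xs ∷ xs!) inj =
    AllP.map⁺ (All.tabulate λ y∈xs fx≡fy → All.lookup x∉xs y∈xs (inj (here refl) (there y∈xs) fx≡fy))
    ∷ unique-map f xs! (λ a b → inj (there a) (there b))

  counting-bijection : ∀ {A B : Set} (p : A → Bool) (q : B → Bool) (f : B → A) (xs : List A) (ys : List B) →
    Unique xs → Unique ys →
    (∀ {b} → b ∈ ys → q b ≡ true → p (f b) ≡ true × f b ∈ xs) →
    (∀ {b b'} → b ∈ ys → b' ∈ ys → q b ≡ true → q b' ≡ true → f b ≡ f b' → b ≡ b') →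
    (∀ {a} → a ∈ xs → p a ≡ true → Σ B λ b → b ∈ ys × q b ≡ true × f b ≡ a) →
    countᵇ p xs ≡ countᵇ q ys
  counting-bijection p q f xs ys xs! ys! maps-to injective onto = begin
    countᵇ p xs                        ≡⟨ count≡length-filter p xs ⟩
    length (filter P? xs)              ≡⟨ ↭-length (∼bag⇒↭ (unique∧set⇒bag (Unique.filter⁺ P? xs!) image! same-elements)) ⟩
    length (map f (filter Q? ys))      ≡⟨ ListP.length-map f (filter Q? ys) ⟩
    length (filter Q? ys)              ≡⟨ count≡length-filter q ys ⟨
    countᵇ q ys                        ∎
    where
    open ≡-Reasoning
    P? = λ a → p a Bool.≟ true
    Q? = λ b → q b Bool.≟ true
    image! : Unique (map f (filter Q? ys))
    image! = unique-map f (Unique.filter⁺ Q? ys!) λ m m' →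
      let (b∈ys , qb) = ∈-filter⁻ Q? {xs = ys} m ; (b'∈ys , qb') = ∈-filter⁻ Q? {xs = ys} m' in injective b∈ys b'∈ys qb qb'
    same-elements : filter P? xs ∼[ set ] map f (filter Q? ys)
    same-elements {a} = mk⇔ to from
      where
      to : a ∈ filter P? xs → a ∈ map f (filter Q? ys)
      to m with ∈-filter⁻ P? m
      ... | a∈xs , pa with onto a∈xs pa
      ... | b , b∈ys , qb , refl = ∈-map⁺ f (∈-filter⁺ Q? b∈ys qb)
      from : a ∈ map f (filter Q? ys) → a ∈ filter P? xs
      from m with ∈-map⁻ f m
      ... | b , b∈ , refl with ∈-filter⁻ Q? b∈
      ... | b∈ys , qb = ∈-filter⁺ P? (proj₂ (maps-to b∈ys qb)) (proj₁ (maps-to b∈ys qb))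

  module _ {A : Set} {k : ℕ} (L : List (Vec A k)) where

    ∈-prepend⁻ : ∀ xs {x w} → (x ∷ w) ∈ concatMap (λ y → map (y ∷_) L) xs → x ∈ xs × w ∈ L
    ∈-prepend⁻ xs m with ∈-concatMap⁻ (λ y → map (y ∷_) L) {xs = xs} m
    ... | any = Any.map head-of any , tail-of (proj₂ (Any.satisfied any))
      where
      head-of : ∀ {x w y} → (x ∷ w) ∈ map (y ∷_) L → x ≡ y
      head-of m with ∈-map⁻ (_ ∷_) m
      ... | _ , _ , refl = refl
      tail-of : ∀ {x w y} → (x ∷ w) ∈ map (y ∷_) L → w ∈ L
      tail-of m with ∈-map⁻ (_ ∷_) m
      ... | _ , u∈L , refl = u∈L

    ∈-prepend⁺ : ∀ xs {x w} → x ∈ xs → w ∈ L → (x ∷ w) ∈ concatMap (λ y → map (y ∷_) L) xs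
    ∈-prepend⁺ xs x∈xs w∈L = ∈-concatMap⁺ (λ y → map (y ∷_) L) (Any.map (λ { refl → ∈-map⁺ (_ ∷_) w∈L }) x∈xs)

    unique-prepend : ∀ {xs} → Unique xs → Unique L → Unique (concatMap (λ y → map (y ∷_) L) xs)
    unique-prepend [] L! = []
    unique-prepend {x ∷ xs} (x∉xs ∷ xs!) L! =
      Unique.++⁺ (Unique.map⁺ VecP.∷-injectiveʳ L!) (unique-prepend xs! L!) disjoint
      where
      disjoint : ∀ {v} → ¬ (v ∈ map (x ∷_) L × v ∈ concatMap (λ y → map (y ∷_) L) xs)
      disjoint (m , m') with ∈-map⁻ (x ∷_) m
      ... | _ , _ , refl = All.lookup x∉xs (proj₁ (∈-prepend⁻ xs m')) refl

  module _ {A : Set} (xs : List A) where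

    allVecs-∈⁻ : ∀ k {v : Vec A k} → v ∈ allVecs xs k → ∀ i → lookup v i ∈ xs
    allVecs-∈⁻ (suc k) {x ∷ w} m Fin.zero = proj₁ (∈-prepend⁻ (allVecs xs k) xs m)
    allVecs-∈⁻ (suc k) {x ∷ w} m (Fin.suc i) = allVecs-∈⁻ k (proj₂ (∈-prepend⁻ (allVecs xs k) xs m)) i

    allVecs-∈⁺ : ∀ k (v : Vec A k) → (∀ i → lookup v i ∈ xs) → v ∈ allVecs xs k
    allVecs-∈⁺ zero [] _ = here refl
    allVecs-∈⁺ (suc k) (x ∷ w) h =
      ∈-prepend⁺ (allVecs xs k) xs (h Fin.zero) (allVecs-∈⁺ k w (λ i → h (Fin.suc i)))

    allVecs-unique : Unique xs → ∀ k → Unique (allVecs xs k)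
    allVecs-unique xs! zero = [] ∷ []
    allVecs-unique xs! (suc k) = unique-prepend (allVecs xs k) xs! (allVecs-unique xs! k)

module CellWords where

  open import Defs
  open Enumeration
  open import Data.Nat as ℕ using (ℕ; zero; suc; _+_; _≡ᵇ_; _<ᵇ_; _≤_; _<_; z≤n; s≤s)
  import Data.Nat.Properties as ℕP
  open import Data.Bool using (Bool; true; false; not; _∧_; if_then_else_; T)
  open import Data.Unit using (tt)
  open import Data.Fin as Fin using (Fin; toℕ; fromℕ<)
  import Data.Fin.Properties as FinP
  open import Data.Vec using (Vec; []; _∷_; lookup; tabulate)
  import Data.Vec.Properties as VecP
  open import Data.List using (List; []; _∷_; _++_; map; concatMap; allFin)
  import Data.List as List
  open import Data.Bool.ListAction using (all; any)
  open import Data.List.Membership.Propositional using (_∈_)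
  open import Data.List.Membership.Propositional.Properties using (∈-++⁻; ∈-++⁺ˡ; ∈-++⁺ʳ; ∈-map⁺; ∈-concatMap⁺; ∈-allFin)
  open import Data.List.Relation.Unary.Any as Any using (here; there)
  open import Data.List.Relation.Unary.Unique.Propositional using (Unique; []; _∷_)
  open import Data.List.Relation.Unary.All using ([]; _∷_)
  import Data.List.Relation.Unary.Unique.Propositional.Properties as Unique
  open import Data.Product using (_×_; _,_; proj₁; proj₂; Σ)
  import Data.Product.Properties as ×P
  open import Data.Sum using (inj₁; inj₂)
  open import Data.Empty using (⊥-elim)
  open import Relation.Nullary using (¬_; yes; no)
  open import Relation.Binary.PropositionalEquality
  open import Function.Base using (_∘_)

  ≡ᵇ-refl : ∀ k → (k ≡ᵇ k) ≡ true
  ≡ᵇ-refl zero = refl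
  ≡ᵇ-refl (suc k) = ≡ᵇ-refl k

  ≡ᵇ⇒≡ : ∀ {m n} → (m ≡ᵇ n) ≡ true → m ≡ n
  ≡ᵇ⇒≡ {m} {n} e = ℕP.≡ᵇ⇒≡ m n (subst T (sym e) tt)

  ≢⇒≡ᵇ-false : ∀ m n → m ≢ n → (m ≡ᵇ n) ≡ false
  ≢⇒≡ᵇ-false zero zero m≢n = ⊥-elim (m≢n refl)
  ≢⇒≡ᵇ-false zero (suc n) _ = refl
  ≢⇒≡ᵇ-false (suc m) zero _ = refl
  ≢⇒≡ᵇ-false (suc m) (suc n) m≢n = ≢⇒≡ᵇ-false m n (m≢n ∘ cong suc)

  <ᵇ⇒< : ∀ {m n} → (m <ᵇ n) ≡ true → m < n
  <ᵇ⇒< {m} {n} e = ℕP.<ᵇ⇒< m n (subst T (sym e) tt)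

  <⇒<ᵇ : ∀ {m n} → m < n → (m <ᵇ n) ≡ true
  <⇒<ᵇ {m} {n} m<n with m <ᵇ n | ℕP.<⇒<ᵇ m<n
  ... | true | _ = refl

  ∧-split : ∀ {a b} → a ∧ b ≡ true → a ≡ true × b ≡ true
  ∧-split {true} {true} _ = refl , refl

  ∧-intro : ∀ {a b} → a ≡ true → b ≡ true → a ∧ b ≡ true
  ∧-intro refl refl = refl

  false≢true : false ≢ true
  false≢true ()

  <-irrefl : ∀ {m} → ¬ m < m
  <-irrefl = ℕP.<-irrefl refl

  all-tabulate⁻ : ∀ {A : Set} {k} (f : Fin k → A) (p : A → Bool) → all p (List.tabulate f) ≡ true →
    ∀ i → p (f i) ≡ true
  all-tabulate⁻ {k = suc k} f p e i with p (f Fin.zero) in p0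
  all-tabulate⁻ {k = suc k} f p e Fin.zero | true = p0
  all-tabulate⁻ {k = suc k} f p e (Fin.suc i) | true = all-tabulate⁻ (f ∘ Fin.suc) p e i

  all-tabulate⁺ : ∀ {A : Set} {k} (f : Fin k → A) (p : A → Bool) → (∀ i → p (f i) ≡ true) →
    all p (List.tabulate f) ≡ true
  all-tabulate⁺ {k = zero} f p h = refl
  all-tabulate⁺ {k = suc k} f p h rewrite h Fin.zero = all-tabulate⁺ (f ∘ Fin.suc) p (h ∘ Fin.suc)

  all-tabulate-false : ∀ {A : Set} {k} (f : Fin k → A) (p : A → Bool) → all p (List.tabulate f) ≡ false →
    Σ (Fin k) λ i → p (f i) ≡ false
  all-tabulate-false {k = suc k} f p e with p (f Fin.zero) in p0
  ... | false = Fin.zero , p0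
  ... | true with all-tabulate-false (f ∘ Fin.suc) p e
  ... | i , pi = Fin.suc i , pi

  any-tabulate⁻ : ∀ {A : Set} {k} (f : Fin k → A) (p : A → Bool) → any p (List.tabulate f) ≡ true →
    Σ (Fin k) λ i → p (f i) ≡ true
  any-tabulate⁻ {k = suc k} f p e with p (f Fin.zero) in p0
  ... | true = Fin.zero , p0
  ... | false with any-tabulate⁻ (f ∘ Fin.suc) p e
  ... | i , pi = Fin.suc i , pi

  any-tabulate⁺ : ∀ {A : Set} {k} (f : Fin k → A) (p : A → Bool) → Σ (Fin k) (λ i → p (f i) ≡ true) →
    any p (List.tabulate f) ≡ true
  any-tabulate⁺ f p (Fin.zero , pi) rewrite pi = refl
  any-tabulate⁺ f p (Fin.suc i , pi) with p (f Fin.zero)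
  ... | true = refl
  ... | false = any-tabulate⁺ (f ∘ Fin.suc) p (i , pi)

  ∀ᵇ⁻ : ∀ {k} (p : Fin k → Bool) → ∀ᵇ p ≡ true → ∀ i → p i ≡ true
  ∀ᵇ⁻ p = all-tabulate⁻ (λ i → i) p

  ∀ᵇ⁺ : ∀ {k} (p : Fin k → Bool) → (∀ i → p i ≡ true) → ∀ᵇ p ≡ true
  ∀ᵇ⁺ p = all-tabulate⁺ (λ i → i) p

  ∃ᵇ⁻ : ∀ {k} (p : Fin k → Bool) → ∃ᵇ p ≡ true → Σ (Fin k) λ i → p i ≡ true
  ∃ᵇ⁻ p = any-tabulate⁻ (λ i → i) p

  ∃ᵇ⁺ : ∀ {k} (p : Fin k → Bool) → Σ (Fin k) (λ i → p i ≡ true) → ∃ᵇ p ≡ true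
  ∃ᵇ⁺ p = any-tabulate⁺ (λ i → i) p

  ⇒ᵇ⁻ : ∀ {a b} → (a ⇒ᵇ b) ≡ true → a ≡ true → b ≡ true
  ⇒ᵇ⁻ {true} e refl = e

  ⇒ᵇ⁺ : ∀ {a b} → (a ≡ true → b ≡ true) → (a ⇒ᵇ b) ≡ true
  ⇒ᵇ⁺ {true} h = h refl
  ⇒ᵇ⁺ {false} h = refl

  nonEmpty⁻ : ∀ {n} (S : Vec Bool n) → not (isEmpty S) ≡ true → Σ (Fin n) λ x → x ∈ᵇ S ≡ true
  nonEmpty⁻ {n} S e with isEmpty S in empty
  ... | false with all-tabulate-false (λ i → i) (λ x → not (x ∈ᵇ S)) empty
  ... | x , x∉S-false = x , not-false x∉S-false
    where
    not-false : ∀ {b} → not b ≡ false → b ≡ true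
    not-false {true} _ = refl

  nonEmpty⁺ : ∀ {n} (S : Vec Bool n) → Σ (Fin n) (λ x → x ∈ᵇ S ≡ true) → not (isEmpty S) ≡ true
  nonEmpty⁺ {n} S (x , x∈S) with isEmpty S in empty
  ... | false = refl
  ... | true = ⊥-elim (false≢true (trans (sym (cong not x∈S)) (all-tabulate⁻ (λ i → i) (λ x → not (x ∈ᵇ S)) empty x)))

  isEmpty⁺ : ∀ {n} (S : Vec Bool n) → (∀ x → x ∈ᵇ S ≡ false) → isEmpty S ≡ true
  isEmpty⁺ S h = all-tabulate⁺ (λ i → i) _ (λ x → cong not (h x))

  partition⁻ : ∀ {n d} (M : Matrix n d) → partitionᵇ M ≡ true → ∀ x → cellsContaining M x ≡ 1
  partition⁻ M e x with cellsContaining M x | all-tabulate⁻ (λ i → i) _ e x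
  ... | 1 | _ = refl

  partition⁺ : ∀ {n d} (M : Matrix n d) → (∀ x → cellsContaining M x ≡ 1) → partitionᵇ M ≡ true
  partition⁺ M one with partitionᵇ M in e
  ... | true = refl
  ... | false with all-tabulate-false (λ i → i) _ e
  ... | x , not-one with cellsContaining M x | one x | not-one
  ... | _ | refl | ()

  -- An element of a bidiagonal matrix lies in some column c, either
  -- on the diagonal (row c) or on the superdiagonal (row c - 1); we record
  -- the column and whether it is on the superdiagonal.

  Cell : Set
  Cell = ℕ × Bool

  column : Cell → ℕ
  column = proj₁

  inRow : Cell → ℕ → Bool
  inRow (c , false) r = r ≡ᵇ c
  inRow (c , true) r = suc r ≡ᵇ c

  -- the superdiagonal cell of column 0 does not exist (it lies in no row)
  valid : Cell → Bool
  valid (c , false) = true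
  valid (zero , true) = false
  valid (suc c , true) = true

  rowIndex : Cell → ℕ
  rowIndex (c , false) = c
  rowIndex (zero , true) = zero
  rowIndex (suc c , true) = c

  inRow-≤ : ∀ c r → inRow c r ≡ true → r ≤ column c
  inRow-≤ (c , false) r e = ℕP.≤-reflexive (≡ᵇ⇒≡ e)
  inRow-≤ (c , true) r e = ℕP.<⇒≤ (ℕP.≤-reflexive (≡ᵇ⇒≡ {suc r} {c} e))

  inRow-bidiagonal : ∀ c r → inRow c r ≡ true → column c ≤ suc r
  inRow-bidiagonal (c , false) r e = ℕP.≤-trans (ℕP.≤-reflexive (sym (≡ᵇ⇒≡ {r} {c} e))) (ℕP.n≤1+n r)
  inRow-bidiagonal (c , true) r e = ℕP.≤-reflexive (sym (≡ᵇ⇒≡ {suc r} {c} e))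

  inRow-rowIndex : ∀ c r → valid c ≡ true → inRow c r ≡ (r ≡ᵇ rowIndex c)
  inRow-rowIndex (c , false) r _ = refl
  inRow-rowIndex (suc c , true) r _ = refl

  rowIndex-≤ : ∀ c → rowIndex c ≤ column c
  rowIndex-≤ (c , false) = ℕP.≤-refl
  rowIndex-≤ (zero , true) = z≤n
  rowIndex-≤ (suc c , true) = ℕP.n≤1+n c

  invalid-inRow : ∀ c → valid c ≡ false → ∀ r → inRow c r ≡ false
  invalid-inRow (zero , true) _ r = refl

  cell-≡ : ∀ a b → valid a ≡ true → valid b ≡ true → column a ≡ column b → rowIndex a ≡ rowIndex b → a ≡ b
  cell-≡ (c , false) (.c , false) _ _ refl _ = refl
  cell-≡ (suc c , true) (.(suc c) , true) _ _ refl _ = refl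
  cell-≡ (c , false) (suc c' , true) _ _ refl e = ⊥-elim (ℕP.1+n≢n e)
  cell-≡ (suc c , true) (c' , false) _ _ refl e = ⊥-elim (ℕP.1+n≢n (sym e))

  cells : ℕ → List Cell
  cells zero = []
  cells (suc d) = cells d ++ ((d , false) ∷ (d , true) ∷ [])

  cells-∈⁻ : ∀ d {c} → c ∈ cells d → column c < d
  cells-∈⁻ (suc d) m with ∈-++⁻ (cells d) m
  ... | inj₁ m' = ℕP.m<n⇒m<1+n (cells-∈⁻ d m')
  ... | inj₂ (here refl) = ℕP.n<1+n d
  ... | inj₂ (there (here refl)) = ℕP.n<1+n d

  cells-∈⁺ : ∀ d c → column c < d → c ∈ cells d
  cells-∈⁺ (suc d) (c , b) (s≤s c≤d) with ℕP.m≤n⇒m<n∨m≡n c≤d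
  ... | inj₁ c<d = ∈-++⁺ˡ (cells-∈⁺ d (c , b) c<d)
  cells-∈⁺ (suc d) (c , false) (s≤s c≤d) | inj₂ refl = ∈-++⁺ʳ (cells c) (here refl)
  cells-∈⁺ (suc d) (c , true) (s≤s c≤d) | inj₂ refl = ∈-++⁺ʳ (cells c) (there (here refl))

  cells-unique : ∀ d → Unique (cells d)
  cells-unique zero = []
  cells-unique (suc d) = Unique.++⁺ (cells-unique d) (((λ ()) ∷ []) ∷ [] ∷ []) disjoint
    where
    disjoint : ∀ {c} → ¬ (c ∈ cells d × c ∈ (d , false) ∷ (d , true) ∷ [])
    disjoint (m , here refl) = <-irrefl (cells-∈⁻ d m)
    disjoint (m , there (here refl)) = <-irrefl (cells-∈⁻ d m)

  Monotone : ∀ {n} → Vec Cell n → Set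
  Monotone v = ∀ x y → column (lookup v x) < column (lookup v y) → toℕ x < toℕ y

  record Admissible (d : ℕ) {n} (v : Vec Cell n) : Set where
    field
      all-valid : ∀ x → valid (lookup v x) ≡ true
      rows-occupied : ∀ r → r < d → Σ (Fin n) λ x → inRow (lookup v x) r ≡ true
      columns-occupied : ∀ c → c < d → Σ (Fin n) λ x → column (lookup v x) ≡ c
      monotone : Monotone v

  atEntry : Cell → ℕ → ℕ → Bool
  atEntry c i j = inRow c i ∧ (j ≡ᵇ column c)

  atEntry⁻ : ∀ c i j → atEntry c i j ≡ true → inRow c i ≡ true × j ≡ column c
  atEntry⁻ c i j e with ∧-split {inRow c i} e
  ... | in-row , in-column = in-row , ≡ᵇ⇒≡ in-column

  matrixOf : ∀ {n d} → Vec Cell n → Matrix n d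
  matrixOf v = tabulate λ i → tabulate λ j → tabulate λ x → atEntry (lookup v x) (toℕ i) (toℕ j)

  ∈-matrixOf : ∀ {n d} (v : Vec Cell n) (i j : Fin d) x →
    x ∈ᵇ entry (matrixOf {n} {d} v) i j ≡ atEntry (lookup v x) (toℕ i) (toℕ j)
  ∈-matrixOf v i j x = begin
    lookup (lookup (lookup (matrixOf v) i) j) x
      ≡⟨ cong (λ row → lookup (lookup row j) x) (VecP.lookup∘tabulate _ i) ⟩
    lookup (lookup (tabulate λ j → tabulate λ x → atEntry (lookup v x) (toℕ i) (toℕ j)) j) x
      ≡⟨ cong (λ S → lookup S x) (VecP.lookup∘tabulate _ j) ⟩
    lookup (tabulate λ x → atEntry (lookup v x) (toℕ i) (toℕ j)) x
      ≡⟨ VecP.lookup∘tabulate _ x ⟩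
    atEntry (lookup v x) (toℕ i) (toℕ j) ∎
    where open ≡-Reasoning

  entryOf : ∀ d c → valid c ≡ true → column c < d →
    Σ (Fin d) λ i → Σ (Fin d) λ j → atEntry c (toℕ i) (toℕ j) ≡ true × toℕ j ≡ column c
  entryOf d c c-valid c<d = fromℕ< r<d , fromℕ< c<d , at-entry , FinP.toℕ-fromℕ< c<d
    where
    r<d = ℕP.≤-<-trans (rowIndex-≤ c) c<d
    at-entry : atEntry c (toℕ (fromℕ< r<d)) (toℕ (fromℕ< c<d)) ≡ true
    at-entry rewrite FinP.toℕ-fromℕ< r<d | FinP.toℕ-fromℕ< c<d | ≡ᵇ-refl (column c)
                   | inRow-rowIndex c (rowIndex c) c-valid | ≡ᵇ-refl (rowIndex c) = refl

  sumMap-zero : ∀ {A : Set} (g : A → ℕ) xs → (∀ y → g y ≡ 0) → sumMap g xs ≡ 0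
  sumMap-zero g [] z = refl
  sumMap-zero g (x ∷ xs) z rewrite z x = sumMap-zero g xs z

  sumMap-tabulate-zero : ∀ {A : Set} k (f : Fin k → A) (g : A → ℕ) → (∀ i → g (f i) ≡ 0) →
    sumMap g (List.tabulate f) ≡ 0
  sumMap-tabulate-zero zero f g z = refl
  sumMap-tabulate-zero (suc k) f g z rewrite z Fin.zero = sumMap-tabulate-zero k (f ∘ Fin.suc) g (z ∘ Fin.suc)

  sumMap-indicator : ∀ {A : Set} k (f : Fin k → A) (g : A → ℕ) c → c < k →
    (∀ i → g (f i) ≡ (if toℕ i ≡ᵇ c then 1 else 0)) → sumMap g (List.tabulate f) ≡ 1
  sumMap-indicator (suc k) f g zero _ h rewrite h Fin.zero =
    cong suc (sumMap-tabulate-zero k (f ∘ Fin.suc) g (h ∘ Fin.suc))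
  sumMap-indicator (suc k) f g (suc c) (s≤s c<k) h rewrite h Fin.zero =
    sumMap-indicator k (f ∘ Fin.suc) g c c<k (h ∘ Fin.suc)

  count-indicator : ∀ k (p : Fin k → Bool) c → c < k → (∀ i → p i ≡ (toℕ i ≡ᵇ c)) → countᵇ p (allFin k) ≡ 1
  count-indicator k p c c<k h =
    trans (as-sum (allFin k)) (sumMap-indicator k (λ i → i) (indicator ∘ p) c c<k (λ i → cong indicator (h i)))
    where
    indicator : Bool → ℕ
    indicator b = if b then 1 else 0
    as-sum : ∀ xs → countᵇ p xs ≡ sumMap (indicator ∘ p) xs
    as-sum [] = refl
    as-sum (x ∷ xs) with p x
    ... | true = cong suc (as-sum xs)
    ... | false = as-sum xs

  positions : (d : ℕ) → List (Fin d × Fin d)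
  positions d = concatMap (λ i → map (λ j → i , j) (allFin d)) (allFin d)

  count-positions : ∀ d c → column c < d →
    countᵇ (λ ij → atEntry c (toℕ (proj₁ ij)) (toℕ (proj₂ ij))) (positions d) ≡ (if valid c then 1 else 0)
  count-positions d c c<d =
    trans (count-concatMap _ (λ i → map (λ j → i , j) (allFin d)) (allFin d))
          (trans (sumMap-cong _ row-count (allFin d) (λ i → count-map _ (λ j → i , j) (allFin d)))
                 (by-validity (valid c) refl))
    where
    row-count : Fin d → ℕ
    row-count i = countᵇ (λ j → atEntry c (toℕ i) (toℕ j)) (allFin d)
    by-validity : ∀ b → valid c ≡ b → sumMap row-count (allFin d) ≡ (if b then 1 else 0)
    by-validity false invalid = sumMap-zero row-count (allFin d) λ i →
      count-false _ (allFin d) λ j → cong (_∧ (toℕ j ≡ᵇ column c)) (invalid-inRow c invalid (toℕ i))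
    by-validity true c-valid =
      sumMap-indicator d (λ i → i) row-count (rowIndex c) (ℕP.≤-<-trans (rowIndex-≤ c) c<d) row-indicator
      where
      row-indicator : ∀ i → row-count i ≡ (if toℕ i ≡ᵇ rowIndex c then 1 else 0)
      row-indicator i rewrite inRow-rowIndex c (toℕ i) c-valid with toℕ i ≡ᵇ rowIndex c
      ... | true = count-indicator d _ (column c) c<d (λ j → refl)
      ... | false = count-false _ (allFin d) (λ j → refl)

  module _ {n d : ℕ} (v : Vec Cell n) (in-range : ∀ x → column (lookup v x) < d) where
    private
      M : Matrix n d
      M = matrixOf {n} {d} v

    cellsContaining-matrixOf : ∀ x → cellsContaining M x ≡ (if valid (lookup v x) then 1 else 0)
    cellsContaining-matrixOf x = begin
      cellsContaining M x
        ≡⟨ count≡length-filter _ (positions d) ⟨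
      countᵇ (λ ij → x ∈ᵇ entry M (proj₁ ij) (proj₂ ij)) (positions d)
        ≡⟨ count-cong _ _ (positions d) (λ ij _ → ∈-matrixOf v (proj₁ ij) (proj₂ ij) x) ⟩
      countᵇ (λ ij → atEntry (lookup v x) (toℕ (proj₁ ij)) (toℕ (proj₂ ij))) (positions d)
        ≡⟨ count-positions d (lookup v x) (in-range x) ⟩
      (if valid (lookup v x) then 1 else 0) ∎
      where open ≡-Reasoning

    partition-matrixOf⁻ : partitionᵇ M ≡ true → ∀ x → valid (lookup v x) ≡ true
    partition-matrixOf⁻ e x = indicator-one (trans (sym (cellsContaining-matrixOf x)) (partition⁻ M e x))
      where
      indicator-one : ∀ {b} → (if b then 1 else 0) ≡ 1 → b ≡ true
      indicator-one {true} _ = refl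

    partition-matrixOf⁺ : (∀ x → valid (lookup v x) ≡ true) → partitionᵇ M ≡ true
    partition-matrixOf⁺ all-valid = partition⁺ M λ x → trans (cellsContaining-matrixOf x) (cong (λ b → if b then 1 else 0) (all-valid x))

    upperTriangular-matrixOf : upperTriangularᵇ M ≡ true
    upperTriangular-matrixOf = ∀ᵇ⁺ _ λ i → ∀ᵇ⁺ _ λ j → ⇒ᵇ⁺ λ j<i →
      isEmpty⁺ (entry M i j) λ x → trans (∈-matrixOf v i j x) (not-below x i j (<ᵇ⇒< j<i))
      where
      not-below : ∀ x (i j : Fin d) → toℕ j < toℕ i → atEntry (lookup v x) (toℕ i) (toℕ j) ≡ false
      not-below x i j j<i with atEntry (lookup v x) (toℕ i) (toℕ j) in at
      ... | false = refl
      ... | true with atEntry⁻ (lookup v x) (toℕ i) (toℕ j) at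
      ... | in-row , j≡c = ⊥-elim (<-irrefl (ℕP.<-≤-trans (subst (_< toℕ i) j≡c j<i) (inRow-≤ (lookup v x) (toℕ i) in-row)))

    bidiagonal-matrixOf : bidiagonalᵇ M ≡ true
    bidiagonal-matrixOf = ∧-intro upperTriangular-matrixOf (∀ᵇ⁺ _ λ i → ∀ᵇ⁺ _ λ j → ⇒ᵇ⁺ λ far →
      isEmpty⁺ (entry M i j) λ x → trans (∈-matrixOf v i j x) (not-far x i j (<ᵇ⇒< far)))
      where
      not-far : ∀ x (i j : Fin d) → suc (toℕ i) < toℕ j → atEntry (lookup v x) (toℕ i) (toℕ j) ≡ false
      not-far x i j far with atEntry (lookup v x) (toℕ i) (toℕ j) in at
      ... | false = refl
      ... | true with atEntry⁻ (lookup v x) (toℕ i) (toℕ j) at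
      ... | in-row , j≡c = ⊥-elim (<-irrefl (ℕP.<-≤-trans (subst (suc (toℕ i) <_) j≡c far) (inRow-bidiagonal (lookup v x) (toℕ i) in-row)))

    rows-matrixOf⁺ : (∀ r → r < d → Σ (Fin n) λ x → inRow (lookup v x) r ≡ true) →
      (∀ᵇ λ i → ∃ᵇ λ j → not (isEmpty (entry M i j))) ≡ true
    rows-matrixOf⁺ occupied = ∀ᵇ⁺ _ λ i → non-empty-row i (occupied (toℕ i) (FinP.toℕ<n i))
      where
      non-empty-row : ∀ (i : Fin d) → Σ (Fin n) (λ x → inRow (lookup v x) (toℕ i) ≡ true) →
        (∃ᵇ λ j → not (isEmpty (entry M i j))) ≡ true
      non-empty-row i (x , in-row) =
        ∃ᵇ⁺ _ (fromℕ< (in-range x) , nonEmpty⁺ (entry M i (fromℕ< (in-range x))) (x , trans (∈-matrixOf v i _ x) at))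
        where
        at : atEntry (lookup v x) (toℕ i) (toℕ (fromℕ< (in-range x))) ≡ true
        at rewrite FinP.toℕ-fromℕ< (in-range x) | ≡ᵇ-refl (column (lookup v x)) | in-row = refl

    rows-matrixOf⁻ : (∀ᵇ λ i → ∃ᵇ λ j → not (isEmpty (entry M i j))) ≡ true →
      ∀ r → r < d → Σ (Fin n) λ x → inRow (lookup v x) r ≡ true
    rows-matrixOf⁻ e r r<d with ∃ᵇ⁻ _ (∀ᵇ⁻ _ e (fromℕ< r<d))
    ... | j , non-empty with nonEmpty⁻ (entry M (fromℕ< r<d) j) non-empty
    ... | x , x∈ with atEntry⁻ (lookup v x) (toℕ (fromℕ< r<d)) (toℕ j) (trans (sym (∈-matrixOf v (fromℕ< r<d) j x)) x∈)
    ... | in-row , _ = x , subst (λ t → inRow (lookup v x) t ≡ true) (FinP.toℕ-fromℕ< r<d) in-row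

    columns-matrixOf⁺ : (∀ x → valid (lookup v x) ≡ true) → (∀ c → c < d → Σ (Fin n) λ x → column (lookup v x) ≡ c) →
      (∀ᵇ λ j → ∃ᵇ λ i → not (isEmpty (entry M i j))) ≡ true
    columns-matrixOf⁺ all-valid occupied = ∀ᵇ⁺ _ λ j → non-empty-column j (occupied (toℕ j) (FinP.toℕ<n j))
      where
      non-empty-column : ∀ (j : Fin d) → Σ (Fin n) (λ x → column (lookup v x) ≡ toℕ j) →
        (∃ᵇ λ i → not (isEmpty (entry M i j))) ≡ true
      non-empty-column j (x , in-column) with entryOf d (lookup v x) (all-valid x) (in-range x)
      ... | i , j' , at , j'≡ = ∃ᵇ⁺ _ (i , nonEmpty⁺ (entry M i j) (x , trans (∈-matrixOf v i j x) at'))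
        where
        at' : atEntry (lookup v x) (toℕ i) (toℕ j) ≡ true
        at' = subst (λ t → atEntry (lookup v x) (toℕ i) t ≡ true) (trans j'≡ in-column) at

    columns-matrixOf⁻ : (∀ᵇ λ j → ∃ᵇ λ i → not (isEmpty (entry M i j))) ≡ true →
      ∀ c → c < d → Σ (Fin n) λ x → column (lookup v x) ≡ c
    columns-matrixOf⁻ e c c<d with ∃ᵇ⁻ _ (∀ᵇ⁻ _ e (fromℕ< c<d))
    ... | i , non-empty with nonEmpty⁻ (entry M i (fromℕ< c<d)) non-empty
    ... | x , x∈ with atEntry⁻ (lookup v x) (toℕ i) (toℕ (fromℕ< c<d)) (trans (sym (∈-matrixOf v i (fromℕ< c<d) x)) x∈)
    ... | _ , in-column = x , sym (trans (sym (FinP.toℕ-fromℕ< c<d)) in-column)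

    colOrder-matrixOf⁺ : Monotone v → colOrderᵇ M ≡ true
    colOrder-matrixOf⁺ monotone =
      ∀ᵇ⁺ _ λ x → ∀ᵇ⁺ _ λ y → ∀ᵇ⁺ _ λ i → ∀ᵇ⁺ _ λ j → ∀ᵇ⁺ _ λ i' → ∀ᵇ⁺ _ λ j' → ⇒ᵇ⁺ (ordered x y i j i' j')
      where
      ordered : ∀ x y i j i' j' → ((x ∈ᵇ entry M i j) ∧ (y ∈ᵇ entry M i' j') ∧ (toℕ j <ᵇ toℕ j')) ≡ true →
        (toℕ x <ᵇ toℕ y) ≡ true
      ordered x y i j i' j' e with ∧-split {x ∈ᵇ entry M i j} e
      ... | x∈ , rest with ∧-split {y ∈ᵇ entry M i' j'} rest
      ... | y∈ , j<j' with atEntry⁻ (lookup v x) (toℕ i) (toℕ j) (trans (sym (∈-matrixOf v i j x)) x∈)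
                         | atEntry⁻ (lookup v y) (toℕ i') (toℕ j') (trans (sym (∈-matrixOf v i' j' y)) y∈)
      ... | _ , j≡ | _ , j'≡ = <⇒<ᵇ (monotone x y (subst₂ _<_ j≡ j'≡ (<ᵇ⇒< j<j')))

    colOrder-matrixOf⁻ : (∀ x → valid (lookup v x) ≡ true) → colOrderᵇ M ≡ true → Monotone v
    colOrder-matrixOf⁻ all-valid e x y lt
      with entryOf d (lookup v x) (all-valid x) (in-range x) | entryOf d (lookup v y) (all-valid y) (in-range y)
    ... | i , j , at , j≡ | i' , j' , at' , j'≡ =
      <ᵇ⇒< (⇒ᵇ⁻ ordered (∧-intro (trans (∈-matrixOf v i j x) at)
                         (∧-intro (trans (∈-matrixOf v i' j' y) at') (<⇒<ᵇ (subst₂ _<_ (sym j≡) (sym j'≡) lt)))))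
      where
      ordered = ∀ᵇ⁻ _ (∀ᵇ⁻ _ (∀ᵇ⁻ _ (∀ᵇ⁻ _ (∀ᵇ⁻ _ (∀ᵇ⁻ _ e x) y) i) j) i') j'

    biPar⇒admissible : isBiParᵇ M ≡ true → Admissible d v
    biPar⇒admissible e with ∧-split {isPartitionMatrixᵇ M} e
    ... | partition-matrix , _ with ∧-split {upperTriangularᵇ M} partition-matrix
    ... | _ , rest with ∧-split {rowsColsNonEmptyᵇ M} rest
    ... | rows-columns , rest' with ∧-split {partitionᵇ M} rest' | ∧-split {∀ᵇ λ i → ∃ᵇ λ j → not (isEmpty (entry M i j))} rows-columns
    ... | partition , col-order | rows , columns = record
      { all-valid = partition-matrixOf⁻ partition
      ; rows-occupied = rows-matrixOf⁻ rows
      ; columns-occupied = columns-matrixOf⁻ columns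
      ; monotone = colOrder-matrixOf⁻ (partition-matrixOf⁻ partition) col-order }

    admissible⇒biPar : Admissible d v → isBiParᵇ M ≡ true
    admissible⇒biPar a = ∧-intro (∧-intro upperTriangular-matrixOf
      (∧-intro (∧-intro (rows-matrixOf⁺ rows-occupied) (columns-matrixOf⁺ all-valid columns-occupied))
               (∧-intro (partition-matrixOf⁺ all-valid) (colOrder-matrixOf⁺ monotone)))) bidiagonal-matrixOf
      where open Admissible a

  vec-ext : ∀ {A : Set} {n} (v v' : Vec A n) → (∀ x → lookup v x ≡ lookup v' x) → v ≡ v'
  vec-ext v v' h = trans (sym (VecP.tabulate∘lookup v)) (trans (VecP.tabulate-cong h) (VecP.tabulate∘lookup v'))

  matrixOf-injective : ∀ {n d} (v v' : Vec Cell n) → (∀ x → column (lookup v x) < d) →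
    (∀ x → valid (lookup v x) ≡ true) → (∀ x → valid (lookup v' x) ≡ true) →
    matrixOf {n} {d} v ≡ matrixOf v' → v ≡ v'
  matrixOf-injective {n} {d} v v' in-range valid-v valid-v' same = vec-ext v v' same-cell
    where
    same-cell : ∀ x → lookup v x ≡ lookup v' x
    same-cell x with entryOf d (lookup v x) (valid-v x) (in-range x)
    ... | i , j , at , j≡ = cell-≡ _ _ (valid-v x) (valid-v' x) (trans (sym j≡) j≡') (trans (sym row) row')
      where
      at' : atEntry (lookup v' x) (toℕ i) (toℕ j) ≡ true
      at' = trans (sym (∈-matrixOf v' i j x)) (trans (cong (λ M → x ∈ᵇ entry M i j) (sym same)) (trans (∈-matrixOf v i j x) at))
      j≡' : toℕ j ≡ column (lookup v' x)
      j≡' = proj₂ (atEntry⁻ (lookup v' x) (toℕ i) (toℕ j) at')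
      row : toℕ i ≡ rowIndex (lookup v x)
      row = ≡ᵇ⇒≡ (trans (sym (inRow-rowIndex (lookup v x) (toℕ i) (valid-v x))) (proj₁ (atEntry⁻ (lookup v x) (toℕ i) (toℕ j) at)))
      row' : toℕ i ≡ rowIndex (lookup v' x)
      row' = ≡ᵇ⇒≡ (trans (sym (inRow-rowIndex (lookup v' x) (toℕ i) (valid-v' x))) (proj₁ (atEntry⁻ (lookup v' x) (toℕ i) (toℕ j) at')))

  cellAt : ℕ → ℕ → Cell
  cellAt i j = j , not (i ≡ᵇ j)

  atEntry-cellAt : ∀ i j → i ≤ j → j ≤ suc i → atEntry (cellAt i j) i j ≡ true
  atEntry-cellAt i j i≤j j≤1+i with i ℕ.≟ j
  ... | yes refl rewrite ≡ᵇ-refl i | ≡ᵇ-refl i = refl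
  ... | no i≢j with ℕP.m≤n⇒m<n∨m≡n j≤1+i
  ... | inj₂ refl rewrite ≢⇒≡ᵇ-false i (suc i) i≢j | ≡ᵇ-refl i = refl
  ... | inj₁ j<1+i = ⊥-elim (i≢j (ℕP.≤-antisym i≤j (ℕP.≤-pred j<1+i)))

  atEntry-cellAt⁻ : ∀ i j i' j' → i ≤ j → j ≤ suc i → atEntry (cellAt i j) i' j' ≡ true → i' ≡ i × j' ≡ j
  atEntry-cellAt⁻ i j i' j' i≤j j≤1+i at with atEntry⁻ (cellAt i j) i' j' at
  ... | in-row , j'≡ with i ℕ.≟ j
  ... | yes refl rewrite ≡ᵇ-refl i = ≡ᵇ⇒≡ in-row , j'≡
  ... | no i≢j with ℕP.m≤n⇒m<n∨m≡n j≤1+i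
  ... | inj₁ j<1+i = ⊥-elim (i≢j (ℕP.≤-antisym i≤j (ℕP.≤-pred j<1+i)))
  ... | inj₂ refl rewrite ≢⇒≡ᵇ-false i (suc i) i≢j = ℕP.suc-injective (≡ᵇ⇒≡ {suc i'} {suc i} in-row) , j'≡

  ∈-positions : ∀ d (i j : Fin d) → (i , j) ∈ positions d
  ∈-positions d i j = ∈-concatMap⁺ (λ i → map (λ j → i , j) (allFin d)) (Any.map (λ { refl → ∈-map⁺ (λ j → i , j) (∈-allFin j) }) (∈-allFin i))

  -- Every bidiagonal partition matrix is matrixOf of a word of cells:
  -- each element lies in exactly one entry, at a position (i , j) with
  -- i ≤ j ≤ i + 1.
  module Cells-of {n d : ℕ} (M : Matrix n d) (biPar : isBiParᵇ M ≡ true) where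
    private
      partition-matrix = proj₁ (∧-split {isPartitionMatrixᵇ M} biPar)
      upper = proj₁ (∧-split {upperTriangularᵇ M} partition-matrix)
      partition = proj₁ (∧-split {partitionᵇ M} (proj₂ (∧-split {rowsColsNonEmptyᵇ M} (proj₂ (∧-split {upperTriangularᵇ M} partition-matrix)))))
      bidiagonal = proj₂ (∧-split {upperTriangularᵇ M} (proj₂ (∧-split {isPartitionMatrixᵇ M} biPar)))

      contains : Fin n → Fin d × Fin d → Bool
      contains x ij = x ∈ᵇ entry M (proj₁ ij) (proj₂ ij)

      counted-once : ∀ x → countᵇ (contains x) (positions d) ≡ 1
      counted-once x = trans (count≡length-filter _ (positions d)) (partition⁻ M partition x)

    position : Fin n → Fin d × Fin d
    position x = proj₁ (count-witness (contains x) (positions d) (counted-once x))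

    position-contains : ∀ x → contains x (position x) ≡ true
    position-contains x = proj₂ (count-witness (contains x) (positions d) (counted-once x))

    position-unique : ∀ x ij → contains x ij ≡ true → ij ≡ position x
    position-unique x ij x∈ with ×P.≡-dec FinP._≟_ FinP._≟_ ij (position x)
    ... | yes same = same
    ... | no different = ⊥-elim (<-irrefl (ℕP.≤-trans
            (count-two (contains x) (∈-positions d _ _) (∈-positions d _ _) different x∈ (position-contains x))
            (ℕP.≤-reflexive (counted-once x))))

    position-upper : ∀ x (i j : Fin d) → contains x (i , j) ≡ true → toℕ i ≤ toℕ j
    position-upper x i j x∈ = ℕP.≮⇒≥ λ j<i →
      false≢true (trans (sym (cong not x∈)) (all-tabulate⁻ (λ y → y) _ (⇒ᵇ⁻ (∀ᵇ⁻ _ (∀ᵇ⁻ _ upper i) j) (<⇒<ᵇ j<i)) x))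

    position-bidiagonal : ∀ x (i j : Fin d) → contains x (i , j) ≡ true → toℕ j ≤ suc (toℕ i)
    position-bidiagonal x i j x∈ = ℕP.≮⇒≥ λ far →
      false≢true (trans (sym (cong not x∈)) (all-tabulate⁻ (λ y → y) _ (⇒ᵇ⁻ (∀ᵇ⁻ _ (∀ᵇ⁻ _ bidiagonal i) j) (<⇒<ᵇ far)) x))

    cellOf : Fin n → Cell
    cellOf x = cellAt (toℕ (proj₁ (position x))) (toℕ (proj₂ (position x)))

    word : Vec Cell n
    word = tabulate cellOf

    word-in-range : ∀ x → column (lookup word x) < d
    word-in-range x rewrite VecP.lookup∘tabulate cellOf x = FinP.toℕ<n (proj₂ (position x))

    private
      at-position : ∀ x → atEntry (cellOf x) (toℕ (proj₁ (position x))) (toℕ (proj₂ (position x))) ≡ true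
      at-position x = atEntry-cellAt _ _ (position-upper x _ _ (position-contains x)) (position-bidiagonal x _ _ (position-contains x))

      same-entries : ∀ (i j : Fin d) x → atEntry (lookup word x) (toℕ i) (toℕ j) ≡ x ∈ᵇ entry M i j
      same-entries i j x rewrite VecP.lookup∘tabulate cellOf x with x ∈ᵇ entry M i j in x∈
      ... | true = subst (λ ij → atEntry (cellOf x) (toℕ (proj₁ ij)) (toℕ (proj₂ ij)) ≡ true)
                         (sym (position-unique x (i , j) x∈)) (at-position x)
      ... | false with atEntry (cellOf x) (toℕ i) (toℕ j) in at
      ... | false = refl
      ... | true with atEntry-cellAt⁻ _ _ (toℕ i) (toℕ j) (position-upper x _ _ (position-contains x))
                        (position-bidiagonal x _ _ (position-contains x)) at
      ... | i≡ , j≡ = ⊥-elim (false≢true (trans (sym x∈)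
                        (subst₂ (λ a b → contains x (a , b) ≡ true) (sym (FinP.toℕ-injective i≡)) (sym (FinP.toℕ-injective j≡))
                                (position-contains x))))

    matrixOf-word : matrixOf word ≡ M
    matrixOf-word = begin
      matrixOf word
        ≡⟨ VecP.tabulate-cong (λ i → VecP.tabulate-cong (λ j → VecP.tabulate-cong (λ x → same-entries i j x))) ⟩
      tabulate (λ i → tabulate (λ j → tabulate (λ x → lookup (lookup (lookup M i) j) x)))
        ≡⟨ VecP.tabulate-cong (λ i → VecP.tabulate-cong (λ j → VecP.tabulate∘lookup (lookup (lookup M i) j))) ⟩
      tabulate (λ i → tabulate (λ j → lookup (lookup M i) j))
        ≡⟨ VecP.tabulate-cong (λ i → VecP.tabulate∘lookup (lookup M i)) ⟩
      tabulate (λ i → lookup M i)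
        ≡⟨ VecP.tabulate∘lookup M ⟩
      M ∎
      where open ≡-Reasoning

  private
    booleans-unique : Unique (true ∷ false ∷ [])
    booleans-unique = ((λ ()) ∷ []) ∷ [] ∷ []

    ∈-booleans : ∀ b → b ∈ true ∷ false ∷ []
    ∈-booleans true = here refl
    ∈-booleans false = there (here refl)

  ∈-allMatrices : ∀ n d M → M ∈ allMatrices n d
  ∈-allMatrices n d M = allVecs-∈⁺ _ d M λ i → allVecs-∈⁺ _ d _ λ j → allVecs-∈⁺ _ n _ λ x → ∈-booleans _

  allMatrices-unique : ∀ n d → Unique (allMatrices n d)
  allMatrices-unique n d = allVecs-unique _ (allVecs-unique _ (allVecs-unique _ booleans-unique n) d) d

  biParCount-words : ∀ n d → biParCount n d ≡ countᵇ (λ v → isBiParᵇ (matrixOf {n} {d} v)) (allVecs (cells d) n)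
  biParCount-words n d = counting-bijection isBiParᵇ (λ v → isBiParᵇ (matrixOf {n} {d} v)) matrixOf
    (allMatrices n d) (allVecs (cells d) n) (allMatrices-unique n d) (allVecs-unique _ (cells-unique d) n)
    (λ _ biPar → biPar , ∈-allMatrices n d _) injective onto
    where
    in-range : ∀ {v} → v ∈ allVecs (cells d) n → ∀ x → column (lookup v x) < d
    in-range m x = cells-∈⁻ d (allVecs-∈⁻ (cells d) n m x)
    injective : ∀ {v v'} → v ∈ allVecs (cells d) n → v' ∈ allVecs (cells d) n →
      isBiParᵇ (matrixOf {n} {d} v) ≡ true → isBiParᵇ (matrixOf {n} {d} v') ≡ true → matrixOf {n} {d} v ≡ matrixOf v' → v ≡ v'
    injective {v} {v'} m m' biPar biPar' = matrixOf-injective v v' (in-range m)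
      (Admissible.all-valid (biPar⇒admissible v (in-range m) biPar))
      (Admissible.all-valid (biPar⇒admissible v' (in-range m') biPar'))
    onto : ∀ {M} → M ∈ allMatrices n d → isBiParᵇ M ≡ true →
      Σ (Vec Cell n) λ v → v ∈ allVecs (cells d) n × isBiParᵇ (matrixOf {n} {d} v) ≡ true × matrixOf v ≡ M
    onto {M} _ biPar = word , allVecs-∈⁺ (cells d) n word (λ x → cells-∈⁺ d _ (word-in-range x)) ,
      subst (λ M → isBiParᵇ M ≡ true) (sym matrixOf-word) biPar , matrixOf-word
      where open Cells-of M biPar

module Automaton where

  open import Defs
  open CellWords
  open import Data.Nat as ℕ using (ℕ; zero; suc; _+_; _≡ᵇ_; z≤n; s≤s; _≤_; _<_)
  import Data.Nat.Properties as ℕP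
  open import Data.Bool using (Bool; true; false; if_then_else_; _∧_; _∨_; not)
  open import Data.Bool.Properties using (∨-zeroʳ)
  open import Data.Unit using (⊤; tt)
  open import Data.Vec using (Vec; []; _∷_; lookup)
  open import Data.Fin using (Fin; zero; suc)
  open import Data.Product using (_×_; _,_; Σ)
  open import Data.Sum using (_⊎_; inj₁; inj₂)
  open import Data.Empty using (⊥; ⊥-elim)
  open import Relation.Nullary using (¬_; yes; no)
  open import Relation.Binary.Definitions using (tri<; tri≈; tri>)
  open import Relation.Binary.PropositionalEquality
  open import Function.Base using (_∘_)
  open import Function.Bundles using (_⇔_; mk⇔; Equivalence)

  -- In state live k cur prev the current column is k, cur records whether
  -- row k is occupied and prev whether row k - 1 is (or there is no such
  -- row).  A column may only be left once row k - 1 is occupied, since no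
  -- later element can reach it.
  data State : Set where
    dead start : State
    live : ℕ → Bool → Bool → State

  step : State → Cell → State
  step dead _ = dead
  step start (zero , false) = live 0 true true
  step start _ = dead
  step (live k cur prev) (c , b) =
    if b ∧ (c ≡ᵇ 0) then dead else
    (if c ≡ᵇ k then live k (not b ∨ cur) (b ∨ prev) else
    (if c ≡ᵇ suc k then (if prev then live (suc k) (not b) (b ∨ cur) else dead) else dead))

  run : ∀ {n} → State → Vec Cell n → State
  run σ [] = σ
  run σ (c ∷ v) = run (step σ c) v

  accepts : ℕ → State → Bool
  accepts d dead = false
  accepts d start = d ≡ᵇ 0
  accepts d (live k cur prev) = (suc k ≡ᵇ d) ∧ cur ∧ prev

  record Completes (d k : ℕ) (cur prev : Bool) {n} (v : Vec Cell n) : Set where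
    field
      from-column : ∀ x → k ≤ column (lookup v x)
      all-valid : ∀ x → valid (lookup v x) ≡ true
      monotone : Monotone v
      columns-occupied : ∀ c → k < c → c < d → Σ (Fin n) λ x → column (lookup v x) ≡ c
      rows-occupied : ∀ r → k < r → r < d → Σ (Fin n) λ x → inRow (lookup v x) r ≡ true
      row-current : cur ≡ true ⊎ Σ (Fin n) λ x → inRow (lookup v x) k ≡ true
      row-previous : prev ≡ true ⊎ Σ (Fin n) λ x → lookup v x ≡ (k , true)

  Invariant : ℕ → State → ∀ {n} → Vec Cell n → Set
  Invariant d dead v = ⊥
  Invariant d start v = Admissible d v
  Invariant d (live k cur prev) v = Completes d k cur prev v

  InRange : ℕ → State → Set
  InRange d (live k cur prev) = k < d
  InRange d _ = ⊤

  1+k≢ᵇk : ∀ k → (suc k ≡ᵇ k) ≡ false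
  1+k≢ᵇk zero = refl
  1+k≢ᵇk (suc k) = 1+k≢ᵇk k

  k≢ᵇ1+k : ∀ k → (k ≡ᵇ suc k) ≡ false
  k≢ᵇ1+k zero = refl
  k≢ᵇ1+k (suc k) = k≢ᵇ1+k k

  step-out : ∀ k cur prev c b → c ≢ k → c ≢ suc k → step (live k cur prev) (c , b) ≡ dead
  step-out k cur prev c b c≢k c≢1+k rewrite ≢⇒≡ᵇ-false c k c≢k | ≢⇒≡ᵇ-false c (suc k) c≢1+k = if-same (b ∧ (c ≡ᵇ 0))
    where
    if-same : ∀ (b : Bool) → (if b then dead else dead) ≡ dead
    if-same true = refl
    if-same false = refl

  inRow-beyond : ∀ c k → suc k ≤ column c → inRow c k ≡ true → c ≡ (suc k , true)
  inRow-beyond (c , false) k le e with ≡ᵇ⇒≡ {k} {c} e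
  ... | refl = ⊥-elim (<-irrefl le)
  inRow-beyond (c , true) k le e with ≡ᵇ⇒≡ {suc k} {c} e
  ... | refl = refl

  empty-start⇒ : ∀ d → Admissible d {0} [] → (d ≡ᵇ 0) ≡ true
  empty-start⇒ d q with d | Admissible.rows-occupied q
  ... | zero | _ = refl
  ... | suc d' | qr with qr 0 (s≤s z≤n)
  ... | () , _

  empty-start⇐ : ∀ d → (d ≡ᵇ 0) ≡ true → Admissible d {0} []
  empty-start⇐ d e rewrite ≡ᵇ⇒≡ {d} {0} e = record
    { all-valid = λ () ; rows-occupied = λ r () ; columns-occupied = λ c () ; monotone = λ () }

  empty-live⇒ : ∀ d k cur prev → k < d → Completes d k cur prev {0} [] → ((suc k ≡ᵇ d) ∧ cur ∧ prev) ≡ true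
  empty-live⇒ d k cur prev k<d c with ℕP.<-cmp (suc k) d
  ... | tri< 1+k<d _ _ with Completes.columns-occupied c (suc k) (ℕP.n<1+n k) 1+k<d
  ... | () , _
  empty-live⇒ d k cur prev k<d c | tri> _ _ d<sk = ⊥-elim (<-irrefl (ℕP.<-≤-trans k<d (ℕP.≤-pred d<sk)))
  empty-live⇒ d k cur prev k<d c | tri≈ _ refl _ with Completes.row-current c | Completes.row-previous c
  ... | inj₁ refl | inj₁ refl rewrite ≡ᵇ-refl k = refl
  ... | inj₂ (() , _) | _
  ... | _ | inj₂ (() , _)

  empty-live⇐ : ∀ d k cur prev → ((suc k ≡ᵇ d) ∧ cur ∧ prev) ≡ true → Completes d k cur prev {0} []
  empty-live⇐ d k cur prev e with ∧-split {suc k ≡ᵇ d} e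
  ... | e1 , e2 with ∧-split {cur} e2 | ≡ᵇ⇒≡ {suc k} {d} e1
  ... | h1 , s1 | refl = record
    { from-column = λ () ; all-valid = λ () ; monotone = λ ()
    ; columns-occupied = λ c k<c c<d → ⊥-elim (<-irrefl (ℕP.<-≤-trans k<c (ℕP.≤-pred c<d)))
    ; rows-occupied = λ c k<c c<d → ⊥-elim (<-irrefl (ℕP.<-≤-trans k<c (ℕP.≤-pred c<d)))
    ; row-current = inj₁ h1 ; row-previous = inj₁ s1 }

  own-row⇒diagonal : ∀ k b → inRow (k , b) k ≡ true → b ≡ false
  own-row⇒diagonal k false _ = refl
  own-row⇒diagonal k true e = ⊥-elim (false≢true (trans (sym (1+k≢ᵇk k)) e))

  valid-cell : ∀ k b → (b ≡ true → k ≢ 0) → valid (k , b) ≡ true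
  valid-cell k false _ = refl
  valid-cell (suc k) true _ = refl
  valid-cell zero true not-column0 = ⊥-elim (not-column0 refl refl)

  stay-preserves : ∀ d k cur prev b {n} (v : Vec Cell n) → Completes d k cur prev ((k , b) ∷ v) → Completes d k (not b ∨ cur) (b ∨ prev) v
  stay-preserves d k cur prev b v c = record
    { from-column = λ x → from-column (suc x)
    ; all-valid = λ x → all-valid (suc x)
    ; monotone = λ x y lt → ℕP.≤-pred (monotone (suc x) (suc y) lt)
    ; columns-occupied = columns-occupied′
    ; rows-occupied = rows-occupied′
    ; row-current = row-current′
    ; row-previous = row-previous′ }
    where
    open Completes c
    columns-occupied′ : ∀ c → k < c → c < d → Σ _ λ x → column (lookup v x) ≡ c
    columns-occupied′ c' k<c c<d with columns-occupied c' k<c c<d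
    ... | zero , refl = ⊥-elim (<-irrefl k<c)
    ... | suc x , e = x , e
    rows-occupied′ : ∀ r → k < r → r < d → Σ _ λ x → inRow (lookup v x) r ≡ true
    rows-occupied′ r k<r r<d with rows-occupied r k<r r<d
    ... | zero , e = ⊥-elim (<-irrefl (ℕP.<-≤-trans k<r (inRow-≤ (k , b) r e)))
    ... | suc x , e = x , e
    row-current′ : (not b ∨ cur) ≡ true ⊎ Σ _ λ x → inRow (lookup v x) k ≡ true
    row-current′ with row-current
    ... | inj₁ refl = inj₁ (∨-zeroʳ (not b))
    ... | inj₂ (suc x , e) = inj₂ (x , e)
    ... | inj₂ (zero , e) = inj₁ (subst (λ t → (not t ∨ cur) ≡ true) (sym (own-row⇒diagonal k b e)) refl)
    row-previous′ : (b ∨ prev) ≡ true ⊎ Σ _ λ x → lookup v x ≡ (k , true)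
    row-previous′ with row-previous
    ... | inj₁ refl = inj₁ (∨-zeroʳ b)
    ... | inj₂ (zero , refl) = inj₁ refl
    ... | inj₂ (suc x , e) = inj₂ (x , e)

  stay-reflects : ∀ d k cur prev b {n} (v : Vec Cell n) → (b ≡ true → k ≢ 0) → Completes d k (not b ∨ cur) (b ∨ prev) v → Completes d k cur prev ((k , b) ∷ v)
  stay-reflects d k cur prev b v not-column0 c = record
    { from-column = from-column′ ; all-valid = all-valid′ ; monotone = monotone′ ; columns-occupied = columns-occupied′ ; rows-occupied = rows-occupied′ ; row-current = row-current′ ; row-previous = row-previous′ }
    where
    open Completes c
    from-column′ : ∀ x → k ≤ column (lookup ((k , b) ∷ v) x)
    from-column′ zero = ℕP.≤-refl
    from-column′ (suc x) = from-column x
    all-valid′ : ∀ x → valid (lookup ((k , b) ∷ v) x) ≡ true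
    all-valid′ (suc x) = all-valid x
    all-valid′ zero = valid-cell k b not-column0
    monotone′ : Monotone ((k , b) ∷ v)
    monotone′ zero zero lt = ⊥-elim (<-irrefl lt)
    monotone′ zero (suc y) lt = s≤s z≤n
    monotone′ (suc x) zero lt = ⊥-elim (<-irrefl (ℕP.<-≤-trans lt (from-column x)))
    monotone′ (suc x) (suc y) lt = s≤s (monotone x y lt)
    columns-occupied′ : ∀ c → k < c → c < d → Σ _ λ x → column (lookup ((k , b) ∷ v) x) ≡ c
    columns-occupied′ c' k<c c<d with columns-occupied c' k<c c<d
    ... | x , e = suc x , e
    rows-occupied′ : ∀ r → k < r → r < d → Σ _ λ x → inRow (lookup ((k , b) ∷ v) x) r ≡ true
    rows-occupied′ r k<r r<d with rows-occupied r k<r r<d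
    ... | x , e = suc x , e
    row-current′ : cur ≡ true ⊎ Σ _ λ x → inRow (lookup ((k , b) ∷ v) x) k ≡ true
    row-current′ with row-current
    ... | inj₂ (x , e) = inj₂ (suc x , e)
    ... | inj₁ e = by-flag b e
      where
      by-flag : ∀ b' → (not b' ∨ cur) ≡ true → cur ≡ true ⊎ Σ _ λ x → inRow (lookup ((k , b') ∷ v) x) k ≡ true
      by-flag false _ = inj₂ (zero , ≡ᵇ-refl k)
      by-flag true e = inj₁ e
    row-previous′ : prev ≡ true ⊎ Σ _ λ x → lookup ((k , b) ∷ v) x ≡ (k , true)
    row-previous′ with row-previous
    ... | inj₂ (x , e) = inj₂ (suc x , e)
    ... | inj₁ e = by-flag b e
      where
      by-flag : ∀ b' → (b' ∨ prev) ≡ true → prev ≡ true ⊎ Σ _ λ x → lookup ((k , b') ∷ v) x ≡ (k , true)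
      by-flag false e = inj₁ e
      by-flag true _ = inj₂ (zero , refl)

  open-needs-prev : ∀ d k cur prev b {n} (v : Vec Cell n) → Completes d k cur prev ((suc k , b) ∷ v) → prev ≡ true
  open-needs-prev d k cur prev b v c with Completes.row-previous c
  ... | inj₁ e = e
  ... | inj₂ (zero , ())
  ... | inj₂ (suc x , e) = ⊥-elim (ℕP.n≮0 (Completes.monotone c (suc x) zero lt))
    where
    lt : column (lookup v x) < suc k
    lt rewrite e = ℕP.n<1+n k

  open-preserves : ∀ d k cur prev b {n} (v : Vec Cell n) → suc k < d → Completes d k cur prev ((suc k , b) ∷ v) → Completes d (suc k) (not b) (b ∨ cur) v
  open-preserves d k cur prev b v 1+k<d c = record
    { from-column = from-column′ ; all-valid = λ x → all-valid (suc x) ; monotone = λ x y lt → ℕP.≤-pred (monotone (suc x) (suc y) lt)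
    ; columns-occupied = columns-occupied′ ; rows-occupied = rows-occupied′ ; row-current = row-current′ ; row-previous = row-previous′ }
    where
    open Completes c
    from-column′ : ∀ x → suc k ≤ column (lookup v x)
    from-column′ x = ℕP.≮⇒≥ (λ lt → ℕP.n≮0 (monotone (suc x) zero lt))
    columns-occupied′ : ∀ c → suc k < c → c < d → Σ _ λ x → column (lookup v x) ≡ c
    columns-occupied′ c' 1+k<c c<d with columns-occupied c' (ℕP.<-trans (ℕP.n<1+n k) 1+k<c) c<d
    ... | zero , refl = ⊥-elim (<-irrefl 1+k<c)
    ... | suc x , e = x , e
    rows-occupied′ : ∀ r → suc k < r → r < d → Σ _ λ x → inRow (lookup v x) r ≡ true
    rows-occupied′ r 1+k<r r<d with rows-occupied r (ℕP.<-trans (ℕP.n<1+n k) 1+k<r) r<d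
    ... | zero , e = ⊥-elim (<-irrefl (ℕP.<-≤-trans 1+k<r (inRow-≤ (suc k , b) r e)))
    ... | suc x , e = x , e
    row-current′ : not b ≡ true ⊎ Σ _ λ x → inRow (lookup v x) (suc k) ≡ true
    row-current′ with rows-occupied (suc k) (ℕP.n<1+n k) 1+k<d
    ... | zero , e = inj₁ (cong not (own-row⇒diagonal (suc k) b e))
    ... | suc x , e = inj₂ (x , e)
    row-previous′ : (b ∨ cur) ≡ true ⊎ Σ _ λ x → lookup v x ≡ (suc k , true)
    row-previous′ with row-current
    ... | inj₁ refl = inj₁ (∨-zeroʳ b)
    ... | inj₂ (suc x , e) = inj₂ (x , inRow-beyond (lookup v x) k (from-column′ x) e)
    ... | inj₂ (zero , e) = inj₁ (by-flag b e)
      where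
      by-flag : ∀ b' → inRow (suc k , b') k ≡ true → (b' ∨ cur) ≡ true
      by-flag true _ = refl
      by-flag false e = ⊥-elim (false≢true (trans (sym (k≢ᵇ1+k k)) e))

  open-reflects : ∀ d k cur b {n} (v : Vec Cell n) → Completes d (suc k) (not b) (b ∨ cur) v → Completes d k cur true ((suc k , b) ∷ v)
  open-reflects d k cur b v c = record
    { from-column = from-column′ ; all-valid = all-valid′ ; monotone = monotone′ ; columns-occupied = columns-occupied′ ; rows-occupied = rows-occupied′ ; row-current = row-current′ ; row-previous = inj₁ refl }
    where
    open Completes c
    from-column′ : ∀ x → k ≤ column (lookup ((suc k , b) ∷ v) x)
    from-column′ zero = ℕP.n≤1+n k
    from-column′ (suc x) = ℕP.≤-trans (ℕP.n≤1+n k) (from-column x)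
    all-valid′ : ∀ x → valid (lookup ((suc k , b) ∷ v) x) ≡ true
    all-valid′ zero = valid-cell (suc k) b (λ _ ())
    all-valid′ (suc x) = all-valid x
    monotone′ : Monotone ((suc k , b) ∷ v)
    monotone′ zero zero lt = ⊥-elim (<-irrefl lt)
    monotone′ zero (suc y) lt = s≤s z≤n
    monotone′ (suc x) zero lt = ⊥-elim (<-irrefl (ℕP.<-≤-trans lt (from-column x)))
    monotone′ (suc x) (suc y) lt = s≤s (monotone x y lt)
    columns-occupied′ : ∀ c → k < c → c < d → Σ _ λ x → column (lookup ((suc k , b) ∷ v) x) ≡ c
    columns-occupied′ c' k<c c<d with c' ℕ.≟ suc k
    ... | yes refl = zero , refl
    ... | no ne with columns-occupied c' (ℕP.≤∧≢⇒< k<c (λ e → ne (sym e))) c<d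
    ... | x , e = suc x , e
    rows-occupied′ : ∀ r → k < r → r < d → Σ _ λ x → inRow (lookup ((suc k , b) ∷ v) x) r ≡ true
    rows-occupied′ r k<r r<d with r ℕ.≟ suc k
    ... | no ne with rows-occupied r (ℕP.≤∧≢⇒< k<r (λ e → ne (sym e))) r<d
    ... | x , e = suc x , e
    rows-occupied′ r k<r r<d | yes refl with row-current
    ... | inj₂ (x , e) = suc x , e
    ... | inj₁ e = zero , by-flag b e
      where
      by-flag : ∀ b' → not b' ≡ true → inRow (suc k , b') (suc k) ≡ true
      by-flag false _ = ≡ᵇ-refl k
      by-flag true ()
    row-current′ : cur ≡ true ⊎ Σ _ λ x → inRow (lookup ((suc k , b) ∷ v) x) k ≡ true
    row-current′ with row-previous
    ... | inj₂ (x , e) = inj₂ (suc x , subst (λ t → inRow t k ≡ true) (sym e) (≡ᵇ-refl k))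
    ... | inj₁ e = by-flag b e
      where
      by-flag : ∀ b' → (b' ∨ cur) ≡ true → cur ≡ true ⊎ Σ _ λ x → inRow (lookup ((suc k , b') ∷ v) x) k ≡ true
      by-flag true _ = inj₂ (zero , ≡ᵇ-refl k)
      by-flag false e = inj₁ e

  -- A cell in any other column violates monotonicity or leaves a column empty.

  far-column-fails : ∀ d k cur prev c0 b {n} (v : Vec Cell n) → c0 ≢ k → c0 ≢ suc k → c0 < d → ¬ Completes d k cur prev ((c0 , b) ∷ v)
  far-column-fails d k cur prev c0 b v c0≢k c0≢1+k c0<d c with ℕP.<-cmp c0 k
  ... | tri< lt _ _ = <-irrefl (ℕP.<-≤-trans lt (Completes.from-column c zero))
  ... | tri≈ _ e _ = c0≢k e
  ... | tri> _ _ gt with Completes.columns-occupied c (suc k) (ℕP.n<1+n k) (ℕP.<-trans 1+k<c0 c0<d)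
    where
    1+k<c0 : suc k < c0
    1+k<c0 = ℕP.≤∧≢⇒< gt (λ e → c0≢1+k (sym e))
  ... | zero , e = c0≢1+k e
  ... | suc x , e = ℕP.n≮0 (Completes.monotone c (suc x) zero lt)
    where
    lt : column (lookup v x) < c0
    lt rewrite e = ℕP.≤∧≢⇒< gt (λ e → c0≢1+k (sym e))

  step-stay : ∀ k cur prev b → (b ≡ true → k ≢ 0) → step (live k cur prev) (k , b) ≡ live k (not b ∨ cur) (b ∨ prev)
  step-stay k cur prev false not-column0 rewrite ≡ᵇ-refl k = refl
  step-stay zero cur prev true not-column0 = ⊥-elim (not-column0 refl refl)
  step-stay (suc k) cur prev true not-column0 rewrite ≡ᵇ-refl k = refl

  step-open : ∀ k cur prev b → step (live k cur prev) (suc k , b) ≡ (if prev then live (suc k) (not b) (b ∨ cur) else dead)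
  step-open k cur prev false rewrite 1+k≢ᵇk k | ≡ᵇ-refl k = refl
  step-open k cur prev true rewrite 1+k≢ᵇk k | ≡ᵇ-refl k = refl

  StepCorrect : ℕ → State → Cell → ∀ {n} → Vec Cell n → Set
  StepCorrect d σ c v = (Invariant d σ (c ∷ v) → Invariant d (step σ c) v) × (Invariant d (step σ c) v → Invariant d σ (c ∷ v)) × InRange d (step σ c)

  correct-stay : ∀ d k cur prev b {n} (v : Vec Cell n) → k < d → StepCorrect d (live k cur prev) (k , b) v
  correct-stay d zero cur prev true v k<d = (λ c → false≢true (Completes.all-valid c zero)) , (λ ()) , tt
  correct-stay d k cur prev false v k<d rewrite step-stay k cur prev false (λ ()) =
    stay-preserves d k cur prev false v , stay-reflects d k cur prev false v (λ ()) , k<d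
  correct-stay d (suc k) cur prev true v k<d rewrite step-stay (suc k) cur prev true (λ _ ()) =
    stay-preserves d (suc k) cur prev true v , stay-reflects d (suc k) cur prev true v (λ _ ()) , k<d

  correct-open : ∀ d k cur prev b {n} (v : Vec Cell n) → suc k < d → StepCorrect d (live k cur prev) (suc k , b) v
  correct-open d k cur prev b v 1+k<d rewrite step-open k cur prev b with prev
  ... | true = open-preserves d k cur true b v 1+k<d , open-reflects d k cur b v , 1+k<d
  ... | false = (λ c → false≢true (open-needs-prev d k cur false b v c)) , (λ ()) , tt

  correct-live : ∀ d k cur prev c0 b {n} (v : Vec Cell n) → k < d → c0 < d → StepCorrect d (live k cur prev) (c0 , b) v
  correct-live d k cur prev c0 b v k<d c0<d with c0 ℕ.≟ k
  ... | yes refl = correct-stay d k cur prev b v k<d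
  ... | no c0≢k with c0 ℕ.≟ suc k
  ... | yes refl = correct-open d k cur prev b v c0<d
  ... | no c0≢1+k rewrite step-out k cur prev c0 b c0≢k c0≢1+k = far-column-fails d k cur prev c0 b v c0≢k c0≢1+k c0<d , (λ ()) , tt

  start-preserves : ∀ d {n} (v : Vec Cell n) → Admissible d ((zero , false) ∷ v) → Completes d 0 true true v
  start-preserves d v a = record
    { from-column = λ _ → z≤n ; all-valid = λ x → all-valid (suc x)
    ; monotone = λ x y lt → ℕP.≤-pred (monotone (suc x) (suc y) lt)
    ; columns-occupied = columns-occupied′ ; rows-occupied = rows-occupied′
    ; row-current = inj₁ refl ; row-previous = inj₁ refl }
    where
    open Admissible a
    columns-occupied′ : ∀ c → 0 < c → c < d → Σ _ λ x → column (lookup v x) ≡ c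
    columns-occupied′ c 0<c c<d with columns-occupied c c<d
    ... | zero , refl = ⊥-elim (<-irrefl 0<c)
    ... | suc x , e = x , e
    rows-occupied′ : ∀ r → 0 < r → r < d → Σ _ λ x → inRow (lookup v x) r ≡ true
    rows-occupied′ r 0<r r<d with rows-occupied r r<d
    ... | zero , e rewrite ≡ᵇ⇒≡ {r} {0} e = ⊥-elim (<-irrefl 0<r)
    ... | suc x , e = x , e

  start-reflects : ∀ d {n} (v : Vec Cell n) → Completes d 0 true true v → Admissible d ((zero , false) ∷ v)
  start-reflects d v c = record
    { all-valid = all-valid′ ; rows-occupied = rows-occupied′ ; columns-occupied = columns-occupied′ ; monotone = monotone′ }
    where
    open Completes c
    all-valid′ : ∀ x → valid (lookup ((zero , false) ∷ v) x) ≡ true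
    all-valid′ zero = refl
    all-valid′ (suc x) = all-valid x
    rows-occupied′ : ∀ r → r < d → Σ _ λ x → inRow (lookup ((zero , false) ∷ v) x) r ≡ true
    rows-occupied′ zero r<d = zero , refl
    rows-occupied′ (suc r) r<d with rows-occupied (suc r) (s≤s z≤n) r<d
    ... | x , e = suc x , e
    columns-occupied′ : ∀ c → c < d → Σ _ λ x → column (lookup ((zero , false) ∷ v) x) ≡ c
    columns-occupied′ zero c<d = zero , refl
    columns-occupied′ (suc c) c<d with columns-occupied (suc c) (s≤s z≤n) c<d
    ... | x , e = suc x , e
    monotone′ : Monotone ((zero , false) ∷ v)
    monotone′ zero zero ()
    monotone′ zero (suc y) lt = s≤s z≤n
    monotone′ (suc x) zero ()
    monotone′ (suc x) (suc y) lt = s≤s (monotone x y lt)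

  -- a first cell outside column 0 leaves column 0 empty
  start-beyond-column0 : ∀ d c b {n} (v : Vec Cell n) → suc c < d → ¬ Admissible d ((suc c , b) ∷ v)
  start-beyond-column0 d c b v 1+c<d a with Admissible.columns-occupied a 0 (ℕP.<-trans (s≤s z≤n) 1+c<d)
  ... | zero , ()
  ... | suc x , e = ℕP.n≮0 (Admissible.monotone a (suc x) zero lt)
    where
    lt : column (lookup v x) < suc c
    lt rewrite e = s≤s z≤n

  correct-start : ∀ d c {n} (v : Vec Cell n) → column c < d → StepCorrect d start c v
  correct-start d (zero , false) v 0<d = start-preserves d v , start-reflects d v , 0<d
  correct-start d (zero , true) v 0<d = (λ a → false≢true (Admissible.all-valid a zero)) , (λ ()) , tt
  correct-start d (suc c , b) v 1+c<d = start-beyond-column0 d c b v 1+c<d , (λ ()) , tt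

  step-correct : ∀ d σ c {n} (v : Vec Cell n) → InRange d σ → column c < d → StepCorrect d σ c v
  step-correct d dead c v _ _ = (λ ()) , (λ ()) , tt
  step-correct d start c v _ c<d = correct-start d c v c<d
  step-correct d (live k cur prev) (c0 , b) v k<d c<d = correct-live d k cur prev c0 b v k<d c<d

  accepts⇔invariant : ∀ d {n} σ (v : Vec Cell n) → InRange d σ → (∀ x → column (lookup v x) < d) →
    Invariant d σ v ⇔ (accepts d (run σ v) ≡ true)
  accepts⇔invariant d dead [] _ _ = mk⇔ (λ ()) (λ ())
  accepts⇔invariant d start [] _ _ = mk⇔ (empty-start⇒ d) (empty-start⇐ d)
  accepts⇔invariant d (live k cur prev) [] k<d _ = mk⇔ (empty-live⇒ d k cur prev k<d) (empty-live⇐ d k cur prev)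
  accepts⇔invariant d σ (c ∷ v) σ-in-range in-range with step-correct d σ c v σ-in-range (in-range zero)
  ... | preserved , reflected , in-range' with accepts⇔invariant d (step σ c) v in-range' (in-range ∘ suc)
  ... | rest = mk⇔ (Equivalence.to rest ∘ preserved) (reflected ∘ Equivalence.from rest)

module AcceptedCount where

  open import Defs
  open Transfer using (Ways; Opening; Ways₀; bidiagonalCount)
  open Enumeration
  open CellWords
  open Automaton
  open import Data.Nat as ℕ using (ℕ; zero; suc; _+_; _≡ᵇ_; z≤n; s≤s; _≤_; _<_)
  import Data.Nat.Properties as ℕP
  open import Data.Bool using (Bool; true; false; if_then_else_; _∧_)
  open import Data.List using ([]; _∷_; map; _++_)
  open import Data.Vec using (Vec; []; _∷_)
  open import Data.Product using (_,_)
  open import Data.Sum using (inj₁; inj₂)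
  open import Relation.Binary.PropositionalEquality

  accepted : ℕ → ℕ → State → ℕ
  accepted d n σ = countᵇ (λ v → accepts d (run σ v)) (allVecs (cells d) n)

  sumCells : ℕ → (Cell → ℕ) → ℕ
  sumCells zero φ = 0
  sumCells (suc d) φ = sumCells d φ + (φ (d , false) + φ (d , true))

  sumMap-cells : ∀ d (φ : Cell → ℕ) → sumMap φ (cells d) ≡ sumCells d φ
  sumMap-cells zero φ = refl
  sumMap-cells (suc d) φ = trans (sumMap-++ (cells d) _)
    (cong₂ _+_ (sumMap-cells d φ) (cong (φ (d , false) +_) (ℕP.+-identityʳ (φ (d , true)))))
    where
    sumMap-++ : ∀ xs ys → sumMap φ (xs ++ ys) ≡ sumMap φ xs + sumMap φ ys
    sumMap-++ [] ys = refl
    sumMap-++ (x ∷ xs) ys = trans (cong (φ x +_) (sumMap-++ xs ys)) (sym (ℕP.+-assoc (φ x) _ _))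

  sumCells-zero : ∀ m (φ : Cell → ℕ) → (∀ c b → c < m → φ (c , b) ≡ 0) → sumCells m φ ≡ 0
  sumCells-zero zero φ z = refl
  sumCells-zero (suc m) φ z = cong₂ _+_ (sumCells-zero m φ (λ c b c<m → z c b (ℕP.m<n⇒m<1+n c<m)))
                                        (cong₂ _+_ (z m false ℕP.≤-refl) (z m true ℕP.≤-refl))

  sumCells-above : ∀ m d (φ : Cell → ℕ) → m ≤ d → (∀ c b → m ≤ c → φ (c , b) ≡ 0) → sumCells d φ ≡ sumCells m φ
  sumCells-above m zero φ z≤n z = refl
  sumCells-above m (suc d) φ m≤1+d z with ℕP.m≤n⇒m<n∨m≡n m≤1+d
  ... | inj₂ refl = refl
  ... | inj₁ m<1+d = trans (cong₂ _+_ (sumCells-above m d φ m≤d z) (cong₂ _+_ (z d false m≤d) (z d true m≤d)))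
                           (ℕP.+-identityʳ _)
    where
    m≤d = ℕP.≤-pred m<1+d

  run-dead : ∀ {n} (v : Vec Cell n) → run dead v ≡ dead
  run-dead [] = refl
  run-dead (c ∷ v) = run-dead v

  accepted-dead : ∀ d n → accepted d n dead ≡ 0
  accepted-dead d n = count-false _ (allVecs (cells d) n) (λ v → cong (accepts d) (run-dead v))

  accepted-suc : ∀ d n σ → accepted d (suc n) σ ≡ sumCells d (λ c → accepted d n (step σ c))
  accepted-suc d n σ = trans (count-concatMap _ (λ x → map (x ∷_) (allVecs (cells d) n)) (cells d))
    (trans (sumMap-cong _ _ (cells d) (λ x → count-map (λ v → accepts d (run σ v)) (x ∷_) (allVecs (cells d) n)))
           (sumMap-cells d _))

  -- From a column k + 1 with r further columns to open, the accepted words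
  -- are counted by Ways.
  LiveCount : ℕ → Set
  LiveCount n = ∀ d k r cur prev → d ≡ suc (suc k + r) → accepted d n (live (suc k) cur prev) ≡ Ways n r cur prev

  opening-count : ∀ n d k r cur prev → LiveCount n → d ≡ suc (suc (suc k) + r) →
    accepted d n (step (live (suc k) cur prev) (suc (suc k) , false))
      + accepted d n (step (live (suc k) cur prev) (suc (suc k) , true))
    ≡ (if prev then Opening n (suc r) cur else 0)
  opening-count n d k r cur prev count-n d≡ rewrite 1+k≢ᵇk (suc k) | ≡ᵇ-refl k with prev
  ... | true = cong₂ _+_ (count-n d (suc k) r true cur d≡) (count-n d (suc k) r false true d≡)
  ... | false = cong₂ _+_ (accepted-dead d n) (accepted-dead d n)

  -- Splitting the words from live (k + 1) cur prev by their first cell: only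
  -- cells in columns k + 1 and k + 2 survive.
  module FirstCell (n d k : ℕ) (cur prev : Bool) (count-n : LiveCount n) where
    φ : Cell → ℕ
    φ c = accepted d n (step (live (suc k) cur prev) c)

    other-columns : ∀ c b → c ≢ suc k → c ≢ suc (suc k) → φ (c , b) ≡ 0
    other-columns c b c≢ c≢' = trans (cong (accepted d n) (step-out (suc k) cur prev c b c≢ c≢')) (accepted-dead d n)

    before : sumCells (suc k) φ ≡ 0
    before = sumCells-zero (suc k) φ (λ c b c<1+k → other-columns c b (ℕP.<⇒≢ c<1+k) (ℕP.<⇒≢ (ℕP.m<n⇒m<1+n c<1+k)))

    stay : ∀ r → d ≡ suc (suc k + r) → φ (suc k , false) + φ (suc k , true) ≡ Ways n r true prev + Ways n r cur true
    stay r d≡ rewrite ≡ᵇ-refl k = cong₂ _+_ (count-n d k r true prev d≡) (count-n d k r cur true d≡)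

    split : ∀ r → d ≡ suc (suc k + r) → sumCells d φ ≡ Ways (suc n) r cur prev
    split zero d≡ = begin
      sumCells d φ
        ≡⟨ cong (λ t → sumCells t φ) (trans d≡ (cong suc (ℕP.+-identityʳ (suc k)))) ⟩
      sumCells (suc k) φ + (φ (suc k , false) + φ (suc k , true))
        ≡⟨ cong₂ _+_ before (stay 0 d≡) ⟩
      Ways n 0 true prev + Ways n 0 cur true
        ≡⟨ sym (ℕP.+-identityʳ _) ⟩
      Ways n 0 true prev + Ways n 0 cur true + 0
        ≡⟨ cong (Ways n 0 true prev + Ways n 0 cur true +_) (no-opening prev) ⟩
      Ways (suc n) 0 cur prev ∎
      where
      open ≡-Reasoning
      no-opening : ∀ b → 0 ≡ (if b then 0 else 0)
      no-opening true = refl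
      no-opening false = refl
    split (suc r) d≡ = begin
      sumCells d φ
        ≡⟨ sumCells-above (suc (suc (suc k))) d φ d≥ beyond ⟩
      (sumCells (suc k) φ + (φ (suc k , false) + φ (suc k , true))) + (φ (suc (suc k) , false) + φ (suc (suc k) , true))
        ≡⟨ cong₂ _+_ (cong₂ _+_ before (stay (suc r) d≡)) (opening-count n d k r cur prev count-n d≡') ⟩
      Ways (suc n) (suc r) cur prev ∎
      where
      open ≡-Reasoning
      d≡' : d ≡ suc (suc (suc k) + r)
      d≡' = trans d≡ (cong suc (ℕP.+-suc (suc k) r))
      d≥ : suc (suc (suc k)) ≤ d
      d≥ rewrite d≡' = s≤s (s≤s (s≤s (ℕP.m≤m+n k r)))
      beyond : ∀ c b → suc (suc (suc k)) ≤ c → φ (c , b) ≡ 0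
      beyond c b 3+k≤c = other-columns c b (λ { refl → ℕP.<⇒≢ (ℕP.<-trans (ℕP.n<1+n (suc k)) 3+k≤c) refl })
                                           (λ { refl → ℕP.<⇒≢ 3+k≤c refl })

  k≢ᵇk+1+r : ∀ k r → (k ≡ᵇ k + suc r) ≡ false
  k≢ᵇk+1+r zero r = refl
  k≢ᵇk+1+r (suc k) r = k≢ᵇk+1+r k r

  accepted-live : ∀ n → LiveCount n
  accepted-live zero d k zero cur prev refl rewrite ℕP.+-identityʳ k | ≡ᵇ-refl k with cur ∧ prev
  ... | true = refl
  ... | false = refl
  accepted-live zero d k (suc r) cur prev refl rewrite k≢ᵇk+1+r k r = refl
  accepted-live (suc n) d k r cur prev d≡ = trans (accepted-suc d n _) (FirstCell.split n d k cur prev (accepted-live n) r d≡)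

  accepted-column0 : ∀ n d r → d ≡ suc r → accepted d n (live 0 true true) ≡ Ways₀ n r
  accepted-column0 zero d zero refl = refl
  accepted-column0 zero d (suc r) refl = refl
  accepted-column0 (suc n) d r d≡ = trans (accepted-suc d n _) (split r d≡)
    where
    φ : Cell → ℕ
    φ c = accepted d n (step (live 0 true true) c)
    other-columns : ∀ c b → c ≢ 0 → c ≢ 1 → φ (c , b) ≡ 0
    other-columns c b c≢0 c≢1 = trans (cong (accepted d n) (step-out 0 true true c b c≢0 c≢1)) (accepted-dead d n)
    split : ∀ r → d ≡ suc r → sumCells d φ ≡ Ways₀ (suc n) r
    split zero refl = cong₂ _+_ (accepted-column0 n 1 0 refl) (accepted-dead 1 n)
    split (suc r) refl = begin
      sumCells d φ
        ≡⟨ sumCells-above 2 d φ (s≤s (s≤s z≤n)) beyond ⟩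
      (0 + (φ (0 , false) + φ (0 , true))) + (φ (1 , false) + φ (1 , true))
        ≡⟨ cong₂ _+_ (cong₂ _+_ (accepted-column0 n d (suc r) refl) (accepted-dead d n))
                     (cong₂ _+_ (accepted-live n d 0 r true true refl) (accepted-live n d 0 r false true refl)) ⟩
      Ways₀ n (suc r) + 0 + Opening n (suc r) true
        ≡⟨ cong (_+ Opening n (suc r) true) (ℕP.+-identityʳ (Ways₀ n (suc r))) ⟩
      Ways₀ (suc n) (suc r) ∎
      where
      open ≡-Reasoning
      beyond : ∀ c b → 2 ≤ c → φ (c , b) ≡ 0
      beyond (suc (suc c)) b (s≤s (s≤s _)) = other-columns (suc (suc c)) b (λ ()) (λ ())

  accepted-start : ∀ n d → accepted d n start ≡ bidiagonalCount n d
  accepted-start zero zero = refl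
  accepted-start zero (suc d) = refl
  accepted-start (suc n) zero = refl
  accepted-start (suc n) (suc d) = begin
    accepted (suc d) (suc n) start          ≡⟨ accepted-suc (suc d) n start ⟩
    sumCells (suc d) φ                      ≡⟨ sumCells-above 1 (suc d) φ (s≤s z≤n) beyond ⟩
    0 + (φ (0 , false) + φ (0 , true))      ≡⟨ cong₂ _+_ (accepted-column0 n (suc d) d refl) (accepted-dead (suc d) n) ⟩
    Ways₀ n d + 0                           ≡⟨ ℕP.+-identityʳ _ ⟩
    bidiagonalCount (suc n) (suc d)         ∎
    where
    open ≡-Reasoning
    φ : Cell → ℕ
    φ c = accepted (suc d) n (step start c)
    beyond : ∀ c b → 1 ≤ c → φ (c , b) ≡ 0
    beyond (suc c) b _ = accepted-dead (suc d) n

open import Data.Nat using (ℕ; zero; suc; _<_)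
open import Data.Bool using (true)
open import Data.Bool.Properties using (⇔→≡)
open import Data.Integer using (+_; _+_)
open import Data.Unit using (tt)
open import Data.Vec using (Vec; lookup)
open import Function.Base using (_∘_)
open import Function.Bundles using (mk⇔; Equivalence)
open import Relation.Binary.PropositionalEquality
open Series using (δ; sh)
open Transfer using (Z; bidiagonalCount; module Elimination)
open Enumeration using (count-cong; allVecs-∈⁻)
open CellWords
open Automaton
open AcceptedCount

biPar≡accepts : ∀ {n d} (v : Vec Cell n) → (∀ x → column (lookup v x) < d) →
  isBiParᵇ (matrixOf {n} {d} v) ≡ accepts d (run start v)
biPar≡accepts {n} {d} v in-range = ⇔→≡ {z = true} (mk⇔
  (Equivalence.to (accepts⇔invariant d start v tt in-range) ∘ biPar⇒admissible v in-range)
  (admissible⇒biPar v in-range ∘ Equivalence.from (accepts⇔invariant d start v tt in-range)))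

biParCount≡bidiagonalCount : ∀ n d → biParCount n d ≡ bidiagonalCount n d
biParCount≡bidiagonalCount n d = begin
  biParCount n d
    ≡⟨ biParCount-words n d ⟩
  countᵇ (λ v → isBiParᵇ (matrixOf {n} {d} v)) (allVecs (cells d) n)
    ≡⟨ count-cong _ _ (allVecs (cells d) n) (λ v v∈ → biPar≡accepts v (λ x → cells-∈⁻ d (allVecs-∈⁻ (cells d) n v∈ x))) ⟩
  accepted d n start
    ≡⟨ accepted-start n d ⟩
  bidiagonalCount n d ∎
  where open ≡-Reasoning

-- F = 1 + xqZ: a non-empty matrix starts in entry (0 , 0).
F-equation : ∀ n d → biParSeries n d ≡ δ n d + sh 1 1 Z n d
F-equation n d rewrite biParCount≡bidiagonalCount n d = by-shape n d
  where
  by-shape : ∀ n d → + bidiagonalCount n d ≡ δ n d + sh 1 1 Z n d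
  by-shape zero zero = refl
  by-shape zero (suc d) = refl
  by-shape (suc n) zero = refl
  by-shape (suc n) (suc d) = refl

proposition12 : ∀ n d → (biParSeries ⋆ denom) n d ≡ numer n d
proposition12 = Elimination.F-rational biParSeries F-equation
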